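{- Let $p$ be a prime, $k\ge 2$, and let $[a_0,\dots,a_{k-1}]$ be an algebraic $k$-gon modulo $p$. Let $f(x)=a_0+a_1x+\dots+a_{k-1}x^{k-1}\in\mathbb{F}_p[x]$ and let $d$ be the degree of $\gcd(f(x),x^k-1)$ in $\mathbb{F}_p[x]$. Then the monodromy group of $[a_0,\dots,a_{k-1}]$ is $C_p^{k-d}\rtimes C_k$.
   Context: For integers $k\ge2$, $n\ge1$, a $k$-tuple of nonnegative integers $[a_0,\dots,a_{k-1}]$ is an algebraic $k$-gon modulo $n$ if $a_0+\dots+a_{k-1}\equiv 0\pmod n$ and $\gcd(a_0,\dots,a_{k-1},n)=1$. Its circulant matrix $C$ is the $k\times k$ matrix with $(i,j)$ entry $a_{(i-j)\bmod k}$. Its monodromy group is $N\rtimes C_k$, where $N\subseteq(\mathbb{Z}/n\mathbb{Z})^k$ is the additive subgroup generated by the columns of $C$ (reduced mod $n$) and $C_k$ acts on $N$ by cyclically permuting vector coordinates. "The monodromy group is $A\rtimes C_k$" for an abelian group $A$ means $N\cong A$. $C_m$ is the cyclic group of order $m$. -}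

module Defs where

open import Data.Nat using (ℕ; zero; suc; _+_; _*_; _∸_; _<_)
open import Data.Nat.GCD using (gcd)
open import Data.Nat.DivMod using (_mod_)
open import Data.Fin using (Fin; toℕ)
open import Data.Nat.ListAction using (sum)
open import Data.List using (List; []; _∷_; _++_; map; upTo; replicate; tabulate; foldr; lookup)
open import Data.Product using (∃; _×_)
open import Relation.Binary.PropositionalEquality using (_≡_)
open import Relation.Nullary using (¬_)

Cong : ℕ → ℕ → ℕ → Set
Cong n a b = ∃ λ x → ∃ λ y → a + x * n ≡ b + y * n

sumFin : ∀ {k} → (Fin k → ℕ) → ℕ
sumFin {k} f = sum (tabulate f)

gcdAll : ∀ {k} → (Fin k → ℕ) → ℕ → ℕ
gcdAll {k} a n = foldr gcd n (tabulate a)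

IsAlgebraicGon : (k n : ℕ) → (Fin k → ℕ) → Set
IsAlgebraicGon k n a = Cong n (sumFin a) 0 × gcdAll a n ≡ 1

circ : ∀ {k} → (Fin k → ℕ) → Fin k → Fin k → ℕ
circ {zero}  a () j
circ {suc m} a i j = a (((toℕ i + suc m) ∸ toℕ j) mod (suc m))

-- Elements of (ℤ/nℤ)^k are represented by vectors Fin k → ℕ, taken up to
-- coordinatewise congruence modulo n.
VecCong : ∀ {k} → ℕ → (Fin k → ℕ) → (Fin k → ℕ) → Set
VecCong n u v = ∀ i → Cong n (u i) (v i)

_⊕_ : ∀ {k} → (Fin k → ℕ) → (Fin k → ℕ) → (Fin k → ℕ)
(u ⊕ v) i = u i + v i

-- Membership in N: the additive subgroup of (ℤ/nℤ)^k generated by the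
-- columns of the circulant matrix, i.e. the ℤ-span (equivalently ℕ-span,
-- since everything is mod n) of the columns, reduced mod n.
InN : ∀ {k} → ℕ → (Fin k → ℕ) → (Fin k → ℕ) → Set
InN {k} n a v = ∃ λ (c : Fin k → ℕ) → VecCong n v (λ i → sumFin (λ j → c j * circ a i j))

-- N ≅ (ℤ/nℤ)^m as abelian groups: there is a map φ : (ℤ/nℤ)^m → (ℤ/nℤ)^k
-- that is well defined, additive, injective, with image exactly N.
NIsoCyclicPower : (k n : ℕ) → (Fin k → ℕ) → ℕ → Set
NIsoCyclicPower k n a m =
  ∃ λ (φ : (Fin m → ℕ) → (Fin k → ℕ)) →
    (∀ x y → VecCong n x y → VecCong n (φ x) (φ y)) ×
    (∀ x y → VecCong n (φ (x ⊕ y)) (φ x ⊕ φ y)) ×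
    (∀ x y → VecCong n (φ x) (φ y) → VecCong n x y) ×
    (∀ x → InN n a (φ x)) ×
    (∀ v → InN n a v → ∃ λ x → VecCong n (φ x) v)

-- Polynomials over 𝔽_p: coefficient lists (constant term first),
-- coefficients taken modulo p.

Poly : Set
Poly = List ℕ

coeff : Poly → ℕ → ℕ
coeff []       _       = 0
coeff (c ∷ cs) zero    = c
coeff (c ∷ cs) (suc n) = coeff cs n

mulCoeff : Poly → Poly → ℕ → ℕ
mulCoeff g h n = sum (map (λ i → coeff g i * coeff h (n ∸ i)) (upTo (suc n)))

PDiv : ℕ → Poly → Poly → Set
PDiv p g h = ∃ λ (q : Poly) → ∀ n → Cong p (mulCoeff g q n) (coeff h n)

PDegree : ℕ → Poly → ℕ → Set
PDegree p g d = ¬ Cong p (coeff g d) 0 × (∀ n → d < n → Cong p (coeff g n) 0)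

-- g is a gcd of f and h in 𝔽_p[x] (defined up to a unit; degree is
-- independent of that choice)
IsPGcd : ℕ → Poly → Poly → Poly → Set
IsPGcd p f h g = PDiv p g f × PDiv p g h × (∀ e → PDiv p e f → PDiv p e h → PDiv p e g)

gonPoly : ∀ {k} → (Fin k → ℕ) → Poly
gonPoly a = tabulate a

-- x^k - 1 in 𝔽_p[x]  (for k ≥ 1; constant coefficient -1 ≡ p - 1)
xk-1 : ℕ → ℕ → Poly
xk-1 p k = (p ∸ 1) ∷ (replicate (k ∸ 1) 0 ++ (1 ∷ []))

-- Identify a vector v ∈ 𝔽ₚᵏ with the polynomial Σ vᵢ xⁱ modulo xᵏ − 1. The circulant matrix of
-- [a₀, …, a_{k−1}] then acts as multiplication by f, so N is the ideal generated by f in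
-- 𝔽ₚ[x]/(xᵏ − 1). Euclid's algorithm writes g = gcd(f, xᵏ − 1) as u f + v (xᵏ − 1), so this ideal
-- is also generated by g. With xᵏ − 1 = g h and deg h = k − d, division by h shows that every
-- element of the ideal is r g with deg r < k − d, and r ↦ r g is injective on such r because 𝔽ₚ[x]
-- has no zero divisors. Hence N ≅ 𝔽ₚ^{k−d}, with coordinates the coefficients of r.

module Submission where

open import Defs hiding (coeff)
open import Data.Nat using (ℕ; _≤_; _∸_; suc; NonZero)
open import Algebra.Bundles using (CommutativeSemiring)
open import Data.Nat.Primality using (Prime)
open import Data.Fin using (Fin)

module Modular (n : ℕ) .{{_ : NonZero n}} where
  open import Level using (0ℓ)
  open import Algebra.Structures using (IsCommutativeSemiring)
  open import Data.Nat using (zero; _+_; _*_; _%_; _/_; pred)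
  open import Data.Nat.Properties hiding (+-*-isCommutativeSemiring; +-*-commutativeSemiring)
  open import Data.Nat.DivMod
  open import Data.Product using (_,_)
  open import Relation.Binary.PropositionalEquality hiding (setoid)
  import Relation.Binary.Reasoning.Setoid

  infix 4 _≈_
  record _≈_ (a b : ℕ) : Set where
    constructor mk≈
    field %-≡ : a % n ≡ b % n

  ≡⇒≈ : ∀ {a b} → a ≡ b → a ≈ b
  ≡⇒≈ a≡b = mk≈ (cong (_% n) a≡b)

  +-cong : ∀ {a b c d} → a ≈ b → c ≈ d → a + c ≈ b + d
  +-cong {a} {b} {c} {d} (mk≈ a≈b) (mk≈ c≈d) = mk≈ (begin
    (a + c) % n           ≡⟨ %-distribˡ-+ a c n ⟩
    (a % n + c % n) % n   ≡⟨ cong₂ (λ x y → (x + y) % n) a≈b c≈d ⟩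
    (b % n + d % n) % n   ≡⟨ %-distribˡ-+ b d n ⟨
    (b + d) % n           ∎)
    where open ≡-Reasoning

  *-cong : ∀ {a b c d} → a ≈ b → c ≈ d → a * c ≈ b * d
  *-cong {a} {b} {c} {d} (mk≈ a≈b) (mk≈ c≈d) = mk≈ (begin
    (a * c) % n           ≡⟨ %-distribˡ-* a c n ⟩
    (a % n * (c % n)) % n ≡⟨ cong₂ (λ x y → (x * y) % n) a≈b c≈d ⟩
    (b % n * (d % n)) % n ≡⟨ %-distribˡ-* b d n ⟨
    (b * d) % n           ∎)
    where open ≡-Reasoning

  +-congˡ : ∀ a {b c} → b ≈ c → a + b ≈ a + c
  +-congˡ a = +-cong {a} (mk≈ refl)

  *-congˡ : ∀ a {b c} → b ≈ c → a * b ≈ a * c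
  *-congˡ a = *-cong {a} (mk≈ refl)

  *-congʳ : ∀ a {b c} → b ≈ c → b * a ≈ c * a
  *-congʳ a b≈c = *-cong b≈c (mk≈ {a} refl)

  +-*-isCommutativeSemiring : IsCommutativeSemiring _≈_ _+_ _*_ 0 1
  +-*-isCommutativeSemiring = record
    { isSemiring = record
      { isSemiringWithoutAnnihilatingZero = record
        { +-isCommutativeMonoid = record
          { isMonoid = record
            { isSemigroup = record
              { isMagma = record
                { isEquivalence = record
                  { refl = mk≈ refl ; sym = λ (mk≈ e) → mk≈ (sym e) ; trans = λ (mk≈ e) (mk≈ f) → mk≈ (trans e f) }
                ; ∙-cong = +-cong }
              ; assoc = λ x y z → ≡⇒≈ (+-assoc x y z) }
            ; identity = (λ x → ≡⇒≈ (+-identityˡ x)) , (λ x → ≡⇒≈ (+-identityʳ x)) }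
          ; comm = λ x y → ≡⇒≈ (+-comm x y) }
        ; *-cong = *-cong
        ; *-assoc = λ x y z → ≡⇒≈ (*-assoc x y z)
        ; *-identity = (λ x → ≡⇒≈ (*-identityˡ x)) , (λ x → ≡⇒≈ (*-identityʳ x))
        ; distrib = (λ x y z → ≡⇒≈ (*-distribˡ-+ x y z)) , (λ x y z → ≡⇒≈ (*-distribʳ-+ x y z)) }
      ; zero = (λ x → ≡⇒≈ (*-zeroˡ x)) , (λ x → ≡⇒≈ (*-zeroʳ x)) }
    ; *-comm = λ x y → ≡⇒≈ (*-comm x y) }

  +-*-commutativeSemiring : CommutativeSemiring 0ℓ 0ℓ
  +-*-commutativeSemiring = record { isCommutativeSemiring = +-*-isCommutativeSemiring }

  open CommutativeSemiring +-*-commutativeSemiring public using (setoid) renaming (refl to ≈-refl; sym to ≈-sym; trans to ≈-trans)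
  module ≈-Reasoning = Relation.Binary.Reasoning.Setoid setoid

  Cong⇒≈ : ∀ {a b} → Cong n a b → a ≈ b
  Cong⇒≈ {a} {b} (x , y , eq) = mk≈ (begin
    a % n           ≡⟨ [m+kn]%n≡m%n a x n ⟨
    (a + x * n) % n ≡⟨ cong (_% n) eq ⟩
    (b + y * n) % n ≡⟨ [m+kn]%n≡m%n b y n ⟩
    b % n           ∎)
    where open ≡-Reasoning

  ≈⇒Cong : ∀ {a b} → a ≈ b → Cong n a b
  ≈⇒Cong {a} {b} (mk≈ eq) = b / n , a / n , (begin
    a + b / n * n                   ≡⟨ cong (_+ b / n * n) (m≡m%n+[m/n]*n a n) ⟩
    a % n + a / n * n + b / n * n   ≡⟨ cong (λ r → r + a / n * n + b / n * n) eq ⟩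
    b % n + a / n * n + b / n * n   ≡⟨ +-assoc (b % n) _ _ ⟩
    b % n + (a / n * n + b / n * n) ≡⟨ cong (b % n +_) (+-comm (a / n * n) _) ⟩
    b % n + (b / n * n + a / n * n) ≡⟨ +-assoc (b % n) _ _ ⟨
    b % n + b / n * n + a / n * n   ≡⟨ cong (_+ a / n * n) (m≡m%n+[m/n]*n b n) ⟨
    b + a / n * n                   ∎)
    where open ≡-Reasoning

  %≡0⇒≈0 : ∀ {a} → a % n ≡ 0 → a ≈ 0
  %≡0⇒≈0 a%n≡0 = mk≈ (trans a%n≡0 (sym (m*n%n≡0 0 n)))

  ≈0⇒%≡0 : ∀ {a} → a ≈ 0 → a % n ≡ 0
  ≈0⇒%≡0 (mk≈ a%n≡0%n) = trans a%n≡0%n (m*n%n≡0 0 n)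

  -_ : ℕ → ℕ
  - a = pred n * a

  +-inverseʳ : ∀ a → a + - a ≈ 0
  +-inverseʳ a = mk≈ (begin
    (a + pred n * a) % n ≡⟨⟩
    (suc (pred n) * a) % n ≡⟨ cong (λ m → (m * a) % n) (suc-pred n) ⟩
    (n * a) % n        ≡⟨ cong (_% n) (*-comm n a) ⟩
    (a * n) % n        ≡⟨ m*n%n≡0 a n ⟩
    0                  ≡⟨ m*n%n≡0 0 n ⟨
    0 % n              ∎)
    where open ≡-Reasoning

module PrimeField (p : ℕ) (p-prime : Prime p) where
  open import Data.Nat as ℕ using (_+_; _*_; _%_; pred; ≢-nonZero)
  open import Data.Nat.Properties hiding (+-*-isCommutativeSemiring; +-*-commutativeSemiring)
  open import Data.Nat.DivMod
  open import Data.Nat.Divisibility using (_∣_; m%n≡0⇒n∣m; n∣m⇒m%n≡0; ∣1⇒≡1)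
  open import Data.Nat.Primality using (euclidsLemma; prime⇒nonZero; ¬prime[1])
  open import Data.Nat.Coprimality using (prime⇒coprime; coprime-Bézout)
  open import Data.Nat.GCD using (module Bézout)
  open import Data.Product using (∃; _,_)
  open import Data.Sum using (inj₁; inj₂)
  open import Relation.Nullary using (¬_; Dec; map′)
  open import Relation.Binary.PropositionalEquality using (_≡_; sym; trans; cong; subst)
  open import Function using (_∘_)
  open import Data.Nat.Tactic.RingSolver using (solve-∀)

  instance
    p≢0 : NonZero p
    p≢0 = prime⇒nonZero p-prime

  open Modular p public

  private
    a≈a%p : ∀ {a} → a ≈ a % p
    a≈a%p {a} = mk≈ (sym (m%n%n≡m%n a p))

  infix 4 _≈?_
  _≈?_ : ∀ a b → Dec (a ≈ b)
  a ≈? b = map′ mk≈ _≈_.%-≡ (a % p ℕ.≟ b % p)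

  ≈0⇒∣ : ∀ {a} → a ≈ 0 → p ∣ a
  ≈0⇒∣ {a} a≈0 = m%n≡0⇒n∣m a p (≈0⇒%≡0 a≈0)

  ∣⇒≈0 : ∀ {a} → p ∣ a → a ≈ 0
  ∣⇒≈0 {a} p∣a = %≡0⇒≈0 (n∣m⇒m%n≡0 a p p∣a)

  1≉0 : ¬ 1 ≈ 0
  1≉0 1≈0 = ¬prime[1] (subst Prime (∣1⇒≡1 (≈0⇒∣ 1≈0)) p-prime)

  *-≉0 : ∀ {a b} → ¬ a ≈ 0 → ¬ b ≈ 0 → ¬ a * b ≈ 0
  *-≉0 {a} {b} a≉0 b≉0 ab≈0 with euclidsLemma a b p-prime (≈0⇒∣ ab≈0)
  ... | inj₁ p∣a = a≉0 (∣⇒≈0 p∣a)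
  ... | inj₂ p∣b = b≉0 (∣⇒≈0 p∣b)

  inverse : ∀ {a} → ¬ a ≈ 0 → ∃ λ b → b * a ≈ 1
  inverse {a} a≉0 with coprime-Bézout (prime⇒coprime p-prime {{≢-nonZero (a≉0 ∘ %≡0⇒≈0)}} (m%n<n a p))
  ... | Bézout.-+ x y 1+xp≡y[a%p] = y , (begin
    y * a           ≈⟨ *-congˡ y a≈a%p ⟩
    y * (a % p)     ≡⟨ 1+xp≡y[a%p] ⟨
    1 + x * p       ≈⟨ mk≈ ([m+kn]%n≡m%n 1 x p) ⟩
    1               ∎)
    where open ≈-Reasoning
  ... | Bézout.+- x y 1+y[a%p]≡xp = - y , (begin
    - y * a                               ≈⟨ *-congˡ (- y) a≈a%p ⟩
    - y * r                               ≡⟨ +-identityʳ _ ⟨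
    - y * r + 0                           ≈⟨ +-congˡ (- y * r) 1+yr≈0 ⟨
    - y * r + (1 + y * r)                 ≡⟨ rearrange (pred p) y r ⟩
    1 + (y * r + - (y * r))               ≈⟨ +-congˡ 1 (+-inverseʳ (y * r)) ⟩
    1 + 0                                 ∎)
    where
    open ≈-Reasoning
    r = a % p
    1+yr≈0 : 1 + y * r ≈ 0
    1+yr≈0 = %≡0⇒≈0 (trans (cong (_% p) 1+y[a%p]≡xp) (m*n%n≡0 x p))
    rearrange : ∀ q y r → q * y * r + (1 + y * r) ≡ 1 + (y * r + q * (y * r))
    rearrange = solve-∀

module Polynomial {c ℓ} (R : CommutativeSemiring c ℓ) where
  open import Algebra.Structures using (IsCommutativeSemiring)
  open import Data.Nat as ℕ using (zero; _<_; z≤n; s≤s)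
  open import Data.Nat.Properties using (≤-trans; m≤n+m; <-cmp; ≮⇒≥)
  open import Data.Empty using (⊥-elim)
  open import Relation.Nullary using (¬_; yes; no)
  open import Relation.Binary.Definitions using (tri<; tri≈; tri>)
  open import Data.List using (List; []; _∷_; map; length; replicate; _++_; tabulate)
  open import Data.Fin as Fin using (toℕ)
  open import Data.Product using (_×_; _,_; proj₁; proj₂)
  open import Function using (_∘_)
  open import Relation.Binary.Bundles using (Setoid)
  open import Relation.Binary.PropositionalEquality as ≡ using (_≡_)
  import Relation.Binary.Reasoning.Setoid as SetoidReasoning

  open CommutativeSemiring R renaming (Carrier to A)

  coeff : List A → ℕ → A
  coeff []      _       = 0#
  coeff (a ∷ P) zero    = a
  coeff (a ∷ P) (suc n) = coeff P n

  infixl 6 _+ₚ_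
  infixl 7 _*ₚ_
  infixr 8 _·_
  infix  4 _≈ₚ_

  _+ₚ_ : List A → List A → List A
  []      +ₚ Q       = Q
  (a ∷ P) +ₚ []      = a ∷ P
  (a ∷ P) +ₚ (b ∷ Q) = a + b ∷ P +ₚ Q

  _·_ : A → List A → List A
  a · P = map (a *_) P

  _*ₚ_ : List A → List A → List A
  []      *ₚ Q = []
  (a ∷ P) *ₚ Q = a · Q +ₚ (0# ∷ P *ₚ Q)

  record _≈ₚ_ (P Q : List A) : Set ℓ where
    constructor mk≈ₚ
    field coeff-≈ : ∀ n → coeff P n ≈ coeff Q n
  open _≈ₚ_ public

  ≈ₚ-setoid : Setoid c ℓ
  ≈ₚ-setoid = record
    { Carrier = List A
    ; _≈_ = _≈ₚ_
    ; isEquivalence = record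
      { refl  = mk≈ₚ λ _ → refl
      ; sym   = λ P≈Q → mk≈ₚ λ n → sym (coeff-≈ P≈Q n)
      ; trans = λ P≈Q Q≈R → mk≈ₚ λ n → trans (coeff-≈ P≈Q n) (coeff-≈ Q≈R n) } }

  open Setoid ≈ₚ-setoid public using () renaming (refl to ≈ₚ-refl; sym to ≈ₚ-sym; trans to ≈ₚ-trans)
  module ≈ₚ-Reasoning = SetoidReasoning ≈ₚ-setoid
  private module ≈-Reasoning = SetoidReasoning setoid

  open import Algebra.Properties.CommutativeSemigroup +-commutativeSemigroup using (interchange; x∙yz≈y∙xz)

  ∷-cong : ∀ {a b P Q} → a ≈ b → P ≈ₚ Q → a ∷ P ≈ₚ b ∷ Q
  ∷-cong a≈b P≈Q = mk≈ₚ λ { zero → a≈b ; (suc n) → coeff-≈ P≈Q n }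

  ∷-injectiveʳ : ∀ {a b P Q} → a ∷ P ≈ₚ b ∷ Q → P ≈ₚ Q
  ∷-injectiveʳ aP≈bQ = mk≈ₚ λ n → coeff-≈ aP≈bQ (suc n)

  ∷-≈[] : ∀ {a P} → a ∷ P ≈ₚ [] → a ≈ 0# × P ≈ₚ []
  ∷-≈[] aP≈0 = coeff-≈ aP≈0 0 , mk≈ₚ (coeff-≈ aP≈0 ∘ suc)

  coeff-+ₚ : ∀ P Q n → coeff (P +ₚ Q) n ≈ coeff P n + coeff Q n
  coeff-+ₚ []      Q       n       = sym (+-identityˡ _)
  coeff-+ₚ (a ∷ P) []      n       = sym (+-identityʳ _)
  coeff-+ₚ (a ∷ P) (b ∷ Q) zero    = refl
  coeff-+ₚ (a ∷ P) (b ∷ Q) (suc n) = coeff-+ₚ P Q n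

  coeff-· : ∀ a P n → coeff (a · P) n ≈ a * coeff P n
  coeff-· a []      n       = sym (zeroʳ a)
  coeff-· a (b ∷ P) zero    = refl
  coeff-· a (b ∷ P) (suc n) = coeff-· a P n

  coeff-*ₚ : ∀ a P Q n → coeff ((a ∷ P) *ₚ Q) n ≈ a * coeff Q n + coeff (0# ∷ P *ₚ Q) n
  coeff-*ₚ a P Q n = trans (coeff-+ₚ (a · Q) _ n) (+-congʳ (coeff-· a Q n))

  +ₚ-cong : ∀ {P P′ Q Q′} → P ≈ₚ P′ → Q ≈ₚ Q′ → P +ₚ Q ≈ₚ P′ +ₚ Q′
  +ₚ-cong {P} {P′} {Q} {Q′} P≈P′ Q≈Q′ = mk≈ₚ λ n → begin
    coeff (P +ₚ Q) n          ≈⟨ coeff-+ₚ P Q n ⟩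
    coeff P n + coeff Q n     ≈⟨ +-cong (coeff-≈ P≈P′ n) (coeff-≈ Q≈Q′ n) ⟩
    coeff P′ n + coeff Q′ n   ≈⟨ coeff-+ₚ P′ Q′ n ⟨
    coeff (P′ +ₚ Q′) n        ∎
    where open ≈-Reasoning

  ·-cong : ∀ {a b P Q} → a ≈ b → P ≈ₚ Q → a · P ≈ₚ b · Q
  ·-cong {a} {b} {P} {Q} a≈b P≈Q = mk≈ₚ λ n → begin
    coeff (a · P) n   ≈⟨ coeff-· a P n ⟩
    a * coeff P n     ≈⟨ *-cong a≈b (coeff-≈ P≈Q n) ⟩
    b * coeff Q n     ≈⟨ coeff-· b Q n ⟨
    coeff (b · Q) n   ∎
    where open ≈-Reasoning

  *ₚ-zeroˡ : ∀ {P} Q → P ≈ₚ [] → P *ₚ Q ≈ₚ []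
  *ₚ-zeroˡ {[]}    Q _    = ≈ₚ-refl
  *ₚ-zeroˡ {a ∷ P} Q aP≈0 = mk≈ₚ λ n → trans (coeff-*ₚ a P Q n) (trans (+-cong (a*Q≈0 n) (shifted n)) (+-identityˡ 0#))
    where
    a*Q≈0 : ∀ n → a * coeff Q n ≈ 0#
    a*Q≈0 n = trans (*-congʳ (proj₁ (∷-≈[] aP≈0))) (zeroˡ _)
    shifted : ∀ n → coeff (0# ∷ P *ₚ Q) n ≈ 0#
    shifted zero    = refl
    shifted (suc n) = coeff-≈ (*ₚ-zeroˡ Q (proj₂ (∷-≈[] aP≈0))) n

  *ₚ-congʳ : ∀ {P P′} Q → P ≈ₚ P′ → P *ₚ Q ≈ₚ P′ *ₚ Q
  *ₚ-congʳ {[]}    {P′}     Q P≈P′ = ≈ₚ-sym (*ₚ-zeroˡ Q (≈ₚ-sym P≈P′))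
  *ₚ-congʳ {a ∷ P} {[]}     Q P≈P′ = *ₚ-zeroˡ Q P≈P′
  *ₚ-congʳ {a ∷ P} {b ∷ P′} Q aP≈bP′ = +ₚ-cong (·-cong (coeff-≈ aP≈bP′ 0) ≈ₚ-refl)
                                               (∷-cong refl (*ₚ-congʳ Q (∷-injectiveʳ aP≈bP′)))

  +ₚ-identityʳ : ∀ P → P +ₚ [] ≈ₚ P
  +ₚ-identityʳ []      = ≈ₚ-refl
  +ₚ-identityʳ (a ∷ P) = ≈ₚ-refl

  +ₚ-assoc : ∀ P Q S → (P +ₚ Q) +ₚ S ≈ₚ P +ₚ (Q +ₚ S)
  +ₚ-assoc P Q S = mk≈ₚ λ n → begin
    coeff ((P +ₚ Q) +ₚ S) n                 ≈⟨ trans (coeff-+ₚ (P +ₚ Q) S n) (+-congʳ (coeff-+ₚ P Q n)) ⟩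
    coeff P n + coeff Q n + coeff S n       ≈⟨ +-assoc _ _ _ ⟩
    coeff P n + (coeff Q n + coeff S n)     ≈⟨ trans (coeff-+ₚ P (Q +ₚ S) n) (+-congˡ (coeff-+ₚ Q S n)) ⟨
    coeff (P +ₚ (Q +ₚ S)) n                 ∎
    where open ≈-Reasoning

  +ₚ-comm : ∀ P Q → P +ₚ Q ≈ₚ Q +ₚ P
  +ₚ-comm P Q = mk≈ₚ λ n → begin
    coeff (P +ₚ Q) n        ≈⟨ coeff-+ₚ P Q n ⟩
    coeff P n + coeff Q n   ≈⟨ +-comm _ _ ⟩
    coeff Q n + coeff P n   ≈⟨ coeff-+ₚ Q P n ⟨
    coeff (Q +ₚ P) n        ∎
    where open ≈-Reasoning

  *ₚ-zeroʳ : ∀ P → P *ₚ [] ≈ₚ []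
  *ₚ-zeroʳ []      = ≈ₚ-refl
  *ₚ-zeroʳ (a ∷ P) = mk≈ₚ λ { zero → refl ; (suc n) → coeff-≈ (*ₚ-zeroʳ P) n }

  0∷-*ₚ : ∀ P Q → (0# ∷ P) *ₚ Q ≈ₚ 0# ∷ P *ₚ Q
  0∷-*ₚ P Q = mk≈ₚ λ n → trans (coeff-*ₚ 0# P Q n) (trans (+-congʳ (zeroˡ _)) (+-identityˡ _))

  monomial : ℕ → A → List A
  monomial s a = replicate s 0# ++ a ∷ []

  coeff-monomial-*ₚ : ∀ s a Q j → coeff (monomial s a *ₚ Q) (s ℕ.+ j) ≈ a * coeff Q j
  coeff-monomial-*ₚ zero    a Q j = begin
    coeff ((a ∷ []) *ₚ Q) j                ≈⟨ coeff-*ₚ a [] Q j ⟩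
    a * coeff Q j + coeff (0# ∷ []) j      ≈⟨ +-congˡ (shifted j) ⟩
    a * coeff Q j + 0#                     ≈⟨ +-identityʳ _ ⟩
    a * coeff Q j                          ∎
    where
    open ≈-Reasoning
    shifted : ∀ n → coeff (0# ∷ []) n ≈ 0#
    shifted zero    = refl
    shifted (suc n) = refl
  coeff-monomial-*ₚ (suc s) a Q j =
    trans (coeff-≈ (0∷-*ₚ (monomial s a) Q) (suc (s ℕ.+ j))) (coeff-monomial-*ₚ s a Q j)

  *ₚ-distribʳ : ∀ S P Q → (P +ₚ Q) *ₚ S ≈ₚ P *ₚ S +ₚ Q *ₚ S
  *ₚ-distribʳ S []      Q       = ≈ₚ-refl
  *ₚ-distribʳ S (a ∷ P) []      = ≈ₚ-sym (+ₚ-identityʳ _)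
  *ₚ-distribʳ S (a ∷ P) (b ∷ Q) = mk≈ₚ λ n → begin
    coeff ((a + b ∷ P +ₚ Q) *ₚ S) n
      ≈⟨ coeff-*ₚ (a + b) (P +ₚ Q) S n ⟩
    (a + b) * coeff S n + coeff (0# ∷ (P +ₚ Q) *ₚ S) n
      ≈⟨ +-congˡ (trans (coeff-≈ shifted n) (coeff-+ₚ (0# ∷ P *ₚ S) (0# ∷ Q *ₚ S) n)) ⟩
    (a + b) * coeff S n + (coeff (0# ∷ P *ₚ S) n + coeff (0# ∷ Q *ₚ S) n)
      ≈⟨ +-congʳ (distribʳ (coeff S n) a b) ⟩
    (a * coeff S n + b * coeff S n) + (coeff (0# ∷ P *ₚ S) n + coeff (0# ∷ Q *ₚ S) n)
      ≈⟨ interchange _ _ _ _ ⟩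
    (a * coeff S n + coeff (0# ∷ P *ₚ S) n) + (b * coeff S n + coeff (0# ∷ Q *ₚ S) n)
      ≈⟨ +-cong (coeff-*ₚ a P S n) (coeff-*ₚ b Q S n) ⟨
    coeff ((a ∷ P) *ₚ S) n + coeff ((b ∷ Q) *ₚ S) n
      ≈⟨ coeff-+ₚ ((a ∷ P) *ₚ S) _ n ⟨
    coeff ((a ∷ P) *ₚ S +ₚ (b ∷ Q) *ₚ S) n
      ∎
    where
    open ≈-Reasoning
    shifted : 0# ∷ (P +ₚ Q) *ₚ S ≈ₚ (0# ∷ P *ₚ S) +ₚ (0# ∷ Q *ₚ S)
    shifted = ∷-cong (sym (+-identityˡ 0#)) (*ₚ-distribʳ S P Q)

  ·-*ₚ-assoc : ∀ a P Q → (a · P) *ₚ Q ≈ₚ a · (P *ₚ Q)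
  ·-*ₚ-assoc a []      Q = ≈ₚ-refl
  ·-*ₚ-assoc a (b ∷ P) Q = mk≈ₚ λ n → begin
    coeff ((a * b ∷ a · P) *ₚ Q) n
      ≈⟨ coeff-*ₚ (a * b) (a · P) Q n ⟩
    a * b * coeff Q n + coeff (0# ∷ (a · P) *ₚ Q) n
      ≈⟨ +-congˡ (coeff-≈ (∷-cong (sym (zeroʳ a)) (·-*ₚ-assoc a P Q)) n) ⟩
    a * b * coeff Q n + coeff (a · (0# ∷ P *ₚ Q)) n
      ≈⟨ +-congˡ (coeff-· a (0# ∷ P *ₚ Q) n) ⟩
    a * b * coeff Q n + a * coeff (0# ∷ P *ₚ Q) n
      ≈⟨ +-congʳ (*-assoc a b (coeff Q n)) ⟩
    a * (b * coeff Q n) + a * coeff (0# ∷ P *ₚ Q) n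
      ≈⟨ distribˡ a _ _ ⟨
    a * (b * coeff Q n + coeff (0# ∷ P *ₚ Q) n)
      ≈⟨ *-congˡ (coeff-*ₚ b P Q n) ⟨
    a * coeff ((b ∷ P) *ₚ Q) n
      ≈⟨ coeff-· a ((b ∷ P) *ₚ Q) n ⟨
    coeff (a · ((b ∷ P) *ₚ Q)) n
      ∎
    where open ≈-Reasoning

  *ₚ-assoc : ∀ P Q S → (P *ₚ Q) *ₚ S ≈ₚ P *ₚ (Q *ₚ S)
  *ₚ-assoc []      Q S = ≈ₚ-refl
  *ₚ-assoc (a ∷ P) Q S = begin
    (a · Q +ₚ (0# ∷ P *ₚ Q)) *ₚ S        ≈⟨ *ₚ-distribʳ S (a · Q) _ ⟩
    (a · Q) *ₚ S +ₚ (0# ∷ P *ₚ Q) *ₚ S   ≈⟨ +ₚ-cong (·-*ₚ-assoc a Q S) (0∷-*ₚ (P *ₚ Q) S) ⟩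
    a · (Q *ₚ S) +ₚ (0# ∷ (P *ₚ Q) *ₚ S) ≈⟨ +ₚ-cong ≈ₚ-refl (∷-cong refl (*ₚ-assoc P Q S)) ⟩
    a · (Q *ₚ S) +ₚ (0# ∷ P *ₚ (Q *ₚ S)) ∎
    where open ≈ₚ-Reasoning

  *ₚ-∷ʳ : ∀ P a Q → P *ₚ (a ∷ Q) ≈ₚ a · P +ₚ (0# ∷ P *ₚ Q)
  *ₚ-∷ʳ []      a Q = mk≈ₚ λ { zero → refl ; (suc n) → refl }
  *ₚ-∷ʳ (b ∷ P) a Q = mk≈ₚ λ
    { zero    → trans (+-identityʳ _) (trans (*-comm b a) (sym (+-identityʳ _)))
    ; (suc n) → begin
        coeff ((b ∷ P) *ₚ (a ∷ Q)) (suc n)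
          ≈⟨ coeff-*ₚ b P (a ∷ Q) (suc n) ⟩
        b * coeff Q n + coeff (P *ₚ (a ∷ Q)) n
          ≈⟨ +-congˡ (trans (coeff-≈ (*ₚ-∷ʳ P a Q) n) (coeff-+ₚ (a · P) _ n)) ⟩
        b * coeff Q n + (coeff (a · P) n + coeff (0# ∷ P *ₚ Q) n)
          ≈⟨ x∙yz≈y∙xz _ _ _ ⟩
        coeff (a · P) n + (b * coeff Q n + coeff (0# ∷ P *ₚ Q) n)
          ≈⟨ +-congˡ (coeff-*ₚ b P Q n) ⟨
        coeff (a · P) n + coeff ((b ∷ P) *ₚ Q) n
          ≈⟨ coeff-+ₚ (a · P) _ n ⟨
        coeff (a · P +ₚ (b ∷ P) *ₚ Q) n
          ∎ }
    where open ≈-Reasoning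

  *ₚ-comm : ∀ P Q → P *ₚ Q ≈ₚ Q *ₚ P
  *ₚ-comm []      Q = ≈ₚ-sym (*ₚ-zeroʳ Q)
  *ₚ-comm (a ∷ P) Q = ≈ₚ-trans (+ₚ-cong ≈ₚ-refl (∷-cong refl (*ₚ-comm P Q))) (≈ₚ-sym (*ₚ-∷ʳ Q a P))

  *ₚ-cong : ∀ {P P′ Q Q′} → P ≈ₚ P′ → Q ≈ₚ Q′ → P *ₚ Q ≈ₚ P′ *ₚ Q′
  *ₚ-cong {P} {P′} {Q} {Q′} P≈P′ Q≈Q′ = begin
    P *ₚ Q   ≈⟨ *ₚ-congʳ Q P≈P′ ⟩
    P′ *ₚ Q  ≈⟨ *ₚ-comm P′ Q ⟩
    Q *ₚ P′  ≈⟨ *ₚ-congʳ P′ Q≈Q′ ⟩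
    Q′ *ₚ P′ ≈⟨ *ₚ-comm Q′ P′ ⟩
    P′ *ₚ Q′ ∎
    where open ≈ₚ-Reasoning

  *ₚ-congˡ : ∀ P {Q Q′} → Q ≈ₚ Q′ → P *ₚ Q ≈ₚ P *ₚ Q′
  *ₚ-congˡ P = *ₚ-cong (≈ₚ-refl {P})

  *ₚ-identityˡ : ∀ P → (1# ∷ []) *ₚ P ≈ₚ P
  *ₚ-identityˡ P = mk≈ₚ λ n → trans (coeff-monomial-*ₚ 0 1# P n) (*-identityˡ _)

  +ₚ-*ₚ-isCommutativeSemiring : IsCommutativeSemiring _≈ₚ_ _+ₚ_ _*ₚ_ [] (1# ∷ [])
  +ₚ-*ₚ-isCommutativeSemiring = record
    { isSemiring = record
      { isSemiringWithoutAnnihilatingZero = record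
        { +-isCommutativeMonoid = record
          { isMonoid = record
            { isSemigroup = record
              { isMagma = record { isEquivalence = Setoid.isEquivalence ≈ₚ-setoid ; ∙-cong = +ₚ-cong }
              ; assoc = +ₚ-assoc }
            ; identity = (λ _ → ≈ₚ-refl) , +ₚ-identityʳ }
          ; comm = +ₚ-comm }
        ; *-cong = *ₚ-cong
        ; *-assoc = *ₚ-assoc
        ; *-identity = *ₚ-identityˡ , (λ P → ≈ₚ-trans (*ₚ-comm P _) (*ₚ-identityˡ P))
        ; distrib = (λ S P Q → ≈ₚ-trans (*ₚ-comm S _)
                                  (≈ₚ-trans (*ₚ-distribʳ S P Q) (+ₚ-cong (*ₚ-comm P S) (*ₚ-comm Q S))))
                  , *ₚ-distribʳ }
      ; zero = (λ _ → ≈ₚ-refl) , *ₚ-zeroʳ }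
    ; *-comm = *ₚ-comm }

  +ₚ-*ₚ-commutativeSemiring : CommutativeSemiring c ℓ
  +ₚ-*ₚ-commutativeSemiring = record { isCommutativeSemiring = +ₚ-*ₚ-isCommutativeSemiring }

  DegreeBelow : ℕ → List A → Set ℓ
  DegreeBelow n P = ∀ i → n ≤ i → coeff P i ≈ 0#

  HasDegree : ℕ → List A → Set ℓ
  HasDegree d P = ¬ coeff P d ≈ 0# × DegreeBelow (suc d) P

  degreeBelow-cong : ∀ {n P Q} → P ≈ₚ Q → DegreeBelow n P → DegreeBelow n Q
  degreeBelow-cong P≈Q deg<P i n≤i = trans (sym (coeff-≈ P≈Q i)) (deg<P i n≤i)

  hasDegree-cong : ∀ {d P Q} → P ≈ₚ Q → HasDegree d P → HasDegree d Q
  hasDegree-cong {d} P≈Q (P[d]≉0 , deg<P) =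
    (λ Q[d]≈0 → P[d]≉0 (trans (coeff-≈ P≈Q d) Q[d]≈0)) , degreeBelow-cong P≈Q deg<P

  hasDegree-unique : ∀ {d e P} → HasDegree d P → HasDegree e P → d ≡ e
  hasDegree-unique {d} {e} (P[d]≉0 , deg<P) (P[e]≉0 , deg<P′) with <-cmp d e
  ... | tri< d<e _ _ = ⊥-elim (P[e]≉0 (deg<P e d<e))
  ... | tri≈ _ d≡e _ = d≡e
  ... | tri> _ _ e<d = ⊥-elim (P[d]≉0 (deg<P′ d e<d))

  degreeBelow⇒≈ₚ : ∀ {n P Q} → DegreeBelow n P → DegreeBelow n Q →
                   (∀ i → i < n → coeff P i ≈ coeff Q i) → P ≈ₚ Q
  degreeBelow⇒≈ₚ {n} {P} {Q} deg<P deg<Q P≈Q<n = mk≈ₚ coeff-≈′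
    where
    coeff-≈′ : ∀ i → coeff P i ≈ coeff Q i
    coeff-≈′ i with i ℕ.<? n
    ... | yes i<n = P≈Q<n i i<n
    ... | no  i≮n = trans (deg<P i (≮⇒≥ i≮n)) (sym (deg<Q i (≮⇒≥ i≮n)))

  degreeBelow-mono : ∀ {m n P} → m ≤ n → DegreeBelow m P → DegreeBelow n P
  degreeBelow-mono m≤n deg<m i n≤i = deg<m i (≤-trans m≤n n≤i)

  degreeBelow-zero : ∀ {P} → DegreeBelow 0 P → P ≈ₚ []
  degreeBelow-zero deg<0 = mk≈ₚ λ i → deg<0 i z≤n

  degreeBelow-tail : ∀ {n a P} → DegreeBelow (suc n) (a ∷ P) → DegreeBelow n P
  degreeBelow-tail deg< i n≤i = deg< (suc i) (s≤s n≤i)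

  degreeBelow-length : ∀ P → DegreeBelow (length P) P
  degreeBelow-length []      i       _         = refl
  degreeBelow-length (a ∷ P) (suc i) (s≤s n≤i) = degreeBelow-length P i n≤i

  *ₚ-degreeBelow : ∀ m n P Q → DegreeBelow m P → DegreeBelow (suc n) Q → DegreeBelow (m ℕ.+ n) (P *ₚ Q)
  *ₚ-degreeBelow m       n []      Q _ _ i _ = refl
  *ₚ-degreeBelow zero    n (a ∷ P) Q deg<P deg<Q i _ = coeff-≈ (*ₚ-zeroˡ Q (degreeBelow-zero {a ∷ P} deg<P)) i
  *ₚ-degreeBelow (suc m) n (a ∷ P) Q deg<P deg<Q (suc i) (s≤s m+n≤i) = begin
    coeff ((a ∷ P) *ₚ Q) (suc i)          ≈⟨ coeff-*ₚ a P Q (suc i) ⟩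
    a * coeff Q (suc i) + coeff (P *ₚ Q) i ≈⟨ +-cong (*-congˡ (deg<Q (suc i) (s≤s (≤-trans (m≤n+m n m) m+n≤i))))
                                                     (*ₚ-degreeBelow m n P Q (degreeBelow-tail {a = a} deg<P) deg<Q i m+n≤i) ⟩
    a * 0# + 0#                            ≈⟨ trans (+-identityʳ _) (zeroʳ a) ⟩
    0#                                     ∎
    where open ≈-Reasoning

  coeff-*ₚ-leading : ∀ m n P Q → DegreeBelow (suc m) P → DegreeBelow (suc n) Q →
                     coeff (P *ₚ Q) (m ℕ.+ n) ≈ coeff P m * coeff Q n
  coeff-*ₚ-leading m       n []      Q deg<P deg<Q = sym (zeroˡ _)
  coeff-*ₚ-leading zero    n (a ∷ P) Q deg<P deg<Q =
    trans (coeff-≈ (*ₚ-congʳ Q (∷-cong refl (degreeBelow-zero {P} (degreeBelow-tail {a = a} deg<P)))) n)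
          (coeff-monomial-*ₚ 0 a Q n)
  coeff-*ₚ-leading (suc m) n (a ∷ P) Q deg<P deg<Q = begin
    coeff ((a ∷ P) *ₚ Q) (suc (m ℕ.+ n))                ≈⟨ coeff-*ₚ a P Q (suc (m ℕ.+ n)) ⟩
    a * coeff Q (suc (m ℕ.+ n)) + coeff (P *ₚ Q) (m ℕ.+ n) ≈⟨ +-cong (*-congˡ (deg<Q _ (s≤s (m≤n+m n m))))
                                                                  (coeff-*ₚ-leading m n P Q (degreeBelow-tail {a = a} deg<P) deg<Q) ⟩
    a * 0# + coeff P m * coeff Q n                       ≈⟨ trans (+-congʳ (zeroʳ a)) (+-identityˡ _) ⟩
    coeff P m * coeff Q n                                ∎
    where open ≈-Reasoning

  coeff-tabulate : ∀ {n} (x : Fin n → A) i → coeff (tabulate x) (toℕ i) ≡ x i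
  coeff-tabulate x Fin.zero    = ≡.refl
  coeff-tabulate x (Fin.suc i) = coeff-tabulate (x ∘ Fin.suc) i

  degreeBelow-tabulate : ∀ {n} (x : Fin n → A) → DegreeBelow n (tabulate x)
  degreeBelow-tabulate {zero}  x i       _         = refl
  degreeBelow-tabulate {suc n} x (suc i) (s≤s n≤i) = degreeBelow-tabulate (x ∘ Fin.suc) i n≤i

  tabulate-cong : ∀ {n} {x y : Fin n → A} → (∀ i → x i ≈ y i) → tabulate x ≈ₚ tabulate y
  tabulate-cong {zero}  x≈y = ≈ₚ-refl
  tabulate-cong {suc n} x≈y = ∷-cong (x≈y Fin.zero) (tabulate-cong (x≈y ∘ Fin.suc))

  tabulate-+ : ∀ {n} (x y : Fin n → A) → tabulate (λ i → x i + y i) ≈ₚ tabulate x +ₚ tabulate y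
  tabulate-+ {zero}  x y = ≈ₚ-refl
  tabulate-+ {suc n} x y = ∷-cong refl (tabulate-+ (x ∘ Fin.suc) (y ∘ Fin.suc))

  tabulate-coeff : ∀ n {P} → DegreeBelow n P → tabulate {n = n} (λ i → coeff P (toℕ i)) ≈ₚ P
  tabulate-coeff zero    {P}     deg<0 = ≈ₚ-sym (degreeBelow-zero deg<0)
  tabulate-coeff (suc n) {[]}    deg<  = mk≈ₚ λ { zero → refl ; (suc i) → coeff-≈ (tabulate-coeff n {[]} (λ _ _ → refl)) i }
  tabulate-coeff (suc n) {a ∷ P} deg<  = ∷-cong refl (tabulate-coeff n (degreeBelow-tail {a = a} deg<))

  ∷-hasDegree : ∀ {d a P} → HasDegree d P → HasDegree (suc d) (a ∷ P)
  ∷-hasDegree (P[d]≉0 , deg<P) = P[d]≉0 , λ { (suc i) (s≤s d<i) → deg<P i d<i }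

  monomial-hasDegree : ∀ j {a} → ¬ a ≈ 0# → HasDegree j (monomial j a)
  monomial-hasDegree zero    a≉0 = a≉0 , λ { (suc i) _ → refl }
  monomial-hasDegree (suc j) a≉0 = ∷-hasDegree (monomial-hasDegree j a≉0)

module PolynomialOverPrimeField (p : ℕ) (p-prime : Prime p) where
  open import Data.Nat as ℕ using (zero; _<_; _≤?_; pred; z≤n; s≤s)
  open import Data.Nat.Properties
    using ( ≤-refl; ≤-trans; ≤-pred; ≰⇒>; m≤n⇒m<n∨m≡n; m≤n⇒m≤1+n; m∸n≤m; m+[n∸m]≡n; m∸n+n≡m
          ; +-cancelˡ-≤; +-monoʳ-≤; +-suc; *-identityʳ; *-zeroʳ; *-assoc )
  open import Data.Nat.ListAction using (sum)
  open import Data.List using (List; []; _∷_; length; map; applyUpTo)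
  open import Data.Maybe using (nothing)
  open import Data.Product using (∃; ∃₂; _×_; _,_; proj₁; proj₂)
  open import Data.Sum using (_⊎_; inj₁; inj₂)
  open import Function using (_∘_)
  open import Relation.Nullary using (yes; no)
  open import Data.Empty using (⊥-elim)
  open import Relation.Binary.PropositionalEquality as ≡ using (_≡_)
  open import Tactic.RingSolver using (solve-∀)
  open import Tactic.RingSolver.Core.AlmostCommutativeRing using (AlmostCommutativeRing; fromCommutativeSemiring)

  open PrimeField p p-prime public
  open Polynomial +-*-commutativeSemiring public hiding (_+ₚ_; _*ₚ_)

  polySolverRing : AlmostCommutativeRing _ _
  polySolverRing = fromCommutativeSemiring +ₚ-*ₚ-commutativeSemiring (λ _ → nothing)

  -- The reflective ring solver only recognises operations written as projections of the ring it is
  -- given, and only inside a module whose parameters are exactly those of that ring: hence the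
  -- polynomial operations are re-exported this way, and every polynomial identity proved by solve-∀
  -- lives in this module.
  open AlmostCommutativeRing polySolverRing public using () renaming (_+_ to _+ₚ_; _*_ to _*ₚ_)


  -- Multiplication by a constant, so that the solver sees negation as an ordinary product.
  -ₚ_ : List ℕ → List ℕ
  -ₚ P = (- 1 ∷ []) *ₚ P

  coeff--ₚ : ∀ P n → coeff (-ₚ P) n ≈ - coeff P n
  coeff--ₚ P n = ≈-trans (coeff-monomial-*ₚ 0 (- 1) P n) (≡⇒≈ (≡.cong (ℕ._* coeff P n) (*-identityʳ (pred p))))

  +ₚ-inverseʳ : ∀ P → P +ₚ -ₚ P ≈ₚ []
  +ₚ-inverseʳ P = mk≈ₚ λ n → begin
    coeff (P +ₚ -ₚ P) n          ≈⟨ coeff-+ₚ P (-ₚ P) n ⟩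
    coeff P n ℕ.+ coeff (-ₚ P) n ≈⟨ +-congˡ (coeff P n) (coeff--ₚ P n) ⟩
    coeff P n ℕ.+ - coeff P n    ≈⟨ +-inverseʳ (coeff P n) ⟩
    0                            ∎
    where open ≈-Reasoning

  x≈y+z⇒z≈x-y : ∀ {P Q S} → P ≈ₚ Q +ₚ S → S ≈ₚ P +ₚ -ₚ Q
  x≈y+z⇒z≈x-y {P} {Q} {S} P≈Q+S = begin
    S                  ≈⟨ +ₚ-identityʳ S ⟨
    S +ₚ []            ≈⟨ +ₚ-cong ≈ₚ-refl (+ₚ-inverseʳ Q) ⟨
    S +ₚ (Q +ₚ -ₚ Q)   ≈⟨ rearrange S Q (- 1 ∷ []) ⟩
    (Q +ₚ S) +ₚ -ₚ Q   ≈⟨ +ₚ-cong P≈Q+S ≈ₚ-refl ⟨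
    P +ₚ -ₚ Q          ∎
    where
    open ≈ₚ-Reasoning
    rearrange : ∀ S Q N → S +ₚ (Q +ₚ N *ₚ Q) ≈ₚ (Q +ₚ S) +ₚ N *ₚ Q
    rearrange = solve-∀ polySolverRing

  x-y≈z⇒x≈z+y : ∀ {P Q S} → P +ₚ -ₚ Q ≈ₚ S → P ≈ₚ S +ₚ Q
  x-y≈z⇒x≈z+y {P} {Q} {S} P-Q≈S = begin
    P                  ≈⟨ +ₚ-identityʳ P ⟨
    P +ₚ []            ≈⟨ +ₚ-cong ≈ₚ-refl (+ₚ-inverseʳ Q) ⟨
    P +ₚ (Q +ₚ -ₚ Q)   ≈⟨ rearrange P Q (- 1 ∷ []) ⟩
    (P +ₚ -ₚ Q) +ₚ Q   ≈⟨ +ₚ-cong P-Q≈S ≈ₚ-refl ⟩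
    S +ₚ Q             ∎
    where
    open ≈ₚ-Reasoning
    rearrange : ∀ P Q N → P +ₚ (Q +ₚ N *ₚ Q) ≈ₚ (P +ₚ N *ₚ Q) +ₚ Q
    rearrange = solve-∀ polySolverRing

  ≈ₚ[]⊎hasDegree : ∀ n {P} → DegreeBelow n P → P ≈ₚ [] ⊎ ∃ λ d → d < n × HasDegree d P
  ≈ₚ[]⊎hasDegree zero    deg<0 = inj₁ (degreeBelow-zero deg<0)
  ≈ₚ[]⊎hasDegree (suc n) {P} deg< with coeff P n ≈? 0
  ... | no  P[n]≉0 = inj₂ (n , ≤-refl , P[n]≉0 , deg<)
  ... | yes P[n]≈0 with ≈ₚ[]⊎hasDegree n deg<n
    where
    deg<n : DegreeBelow n P
    deg<n i n≤i with m≤n⇒m<n∨m≡n n≤i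
    ... | inj₁ n<i    = deg< i n<i
    ... | inj₂ ≡.refl = P[n]≈0
  ...   | inj₁ P≈0             = inj₁ P≈0
  ...   | inj₂ (d , d<n , deg) = inj₂ (d , m≤n⇒m≤1+n d<n , deg)

  *ₚ-hasDegree : ∀ {d e P Q} → HasDegree d P → HasDegree e Q → HasDegree (d ℕ.+ e) (P *ₚ Q)
  *ₚ-hasDegree {d} {e} {P} {Q} (P[d]≉0 , deg<P) (Q[e]≉0 , deg<Q) =
    (λ PQ[d+e]≈0 → *-≉0 P[d]≉0 Q[e]≉0 (≈-trans (≈-sym (coeff-*ₚ-leading d e P Q deg<P deg<Q)) PQ[d+e]≈0)) ,
    *ₚ-degreeBelow (suc d) e P Q deg<P deg<Q

  *ₚ-cancelʳ : ∀ {d G P Q} → HasDegree d G → P *ₚ G ≈ₚ Q *ₚ G → P ≈ₚ Q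
  *ₚ-cancelʳ {d} {G} {P} {Q} G-deg PG≈QG with ≈ₚ[]⊎hasDegree (length (P +ₚ -ₚ Q)) (degreeBelow-length (P +ₚ -ₚ Q))
  ... | inj₁ P-Q≈0            = x-y≈z⇒x≈z+y P-Q≈0
  ... | inj₂ (s , _ , P-Q-deg) =
    ⊥-elim (proj₁ (*ₚ-hasDegree {P = P +ₚ -ₚ Q} {Q = G} P-Q-deg G-deg) (coeff-≈ [P-Q]G≈0 (s ℕ.+ d)))
    where
    [P-Q]G≈0 : (P +ₚ -ₚ Q) *ₚ G ≈ₚ []
    [P-Q]G≈0 = begin
      (P +ₚ -ₚ Q) *ₚ G           ≈⟨ distribute P Q (- 1 ∷ []) G ⟩
      P *ₚ G +ₚ -ₚ (Q *ₚ G)      ≈⟨ +ₚ-cong PG≈QG ≈ₚ-refl ⟩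
      Q *ₚ G +ₚ -ₚ (Q *ₚ G)      ≈⟨ +ₚ-inverseʳ (Q *ₚ G) ⟩
      []                         ∎
      where
      open ≈ₚ-Reasoning
      distribute : ∀ P Q N G → (P +ₚ N *ₚ Q) *ₚ G ≈ₚ P *ₚ G +ₚ N *ₚ (Q *ₚ G)
      distribute = solve-∀ polySolverRing

  degreeBelow-cancel : ∀ {e n c B P} → DegreeBelow (suc e) B → e ≤ n → DegreeBelow (suc n) P →
                       c ℕ.* coeff B e ≈ coeff P n →
                       DegreeBelow n (P +ₚ -ₚ (monomial (n ∸ e) c *ₚ B))
  degreeBelow-cancel {e} {n} {c} {B} {P} deg<B e≤n deg<P cB[e]≈P[n] i n≤i =
    ≡.subst (λ i → coeff (P +ₚ -ₚ (M *ₚ B)) i ≈ 0) s+j≡i (vanishes (i ∸ s) e≤j)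
    where
    s = n ∸ e
    M = monomial s c
    s+e≡n : s ℕ.+ e ≡ n
    s+e≡n = m∸n+n≡m e≤n
    s+j≡i : s ℕ.+ (i ∸ s) ≡ i
    s+j≡i = m+[n∸m]≡n (≤-trans (m∸n≤m n e) n≤i)
    e≤j : e ≤ i ∸ s
    e≤j = +-cancelˡ-≤ s e (i ∸ s) (≡.subst₂ _≤_ (≡.sym s+e≡n) (≡.sym s+j≡i) n≤i)
    coeff-P-MB : ∀ j → coeff (P +ₚ -ₚ (M *ₚ B)) (s ℕ.+ j) ≈ coeff P (s ℕ.+ j) ℕ.+ - (c ℕ.* coeff B j)
    coeff-P-MB j = ≈-trans (coeff-+ₚ P _ (s ℕ.+ j))
                           (+-congˡ (coeff P (s ℕ.+ j)) (≈-trans (coeff--ₚ (M *ₚ B) (s ℕ.+ j))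
                                                                 (*-congˡ (pred p) (coeff-monomial-*ₚ s c B j))))
    vanishes : ∀ j → e ≤ j → coeff (P +ₚ -ₚ (M *ₚ B)) (s ℕ.+ j) ≈ 0
    vanishes j e≤j with m≤n⇒m<n∨m≡n e≤j
    ... | inj₁ e<j = begin
      coeff (P +ₚ -ₚ (M *ₚ B)) (s ℕ.+ j)      ≈⟨ coeff-P-MB j ⟩
      coeff P (s ℕ.+ j) ℕ.+ - (c ℕ.* coeff B j) ≈⟨ +-cong P[s+j]≈0 (*-congˡ (pred p) (*-congˡ c (deg<B j e<j))) ⟩
      0 ℕ.+ - (c ℕ.* 0)                        ≡⟨ ≡.trans (≡.cong (pred p ℕ.*_) (*-zeroʳ c)) (*-zeroʳ (pred p)) ⟩
      0                                        ∎
      where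
      open ≈-Reasoning
      P[s+j]≈0 : coeff P (s ℕ.+ j) ≈ 0
      P[s+j]≈0 = deg<P (s ℕ.+ j) (≡.subst (ℕ._≤ s ℕ.+ j) (≡.trans (+-suc s e) (≡.cong suc s+e≡n)) (+-monoʳ-≤ s e<j))
    ... | inj₂ ≡.refl = begin
      coeff (P +ₚ -ₚ (M *ₚ B)) (s ℕ.+ e)      ≈⟨ coeff-P-MB e ⟩
      coeff P (s ℕ.+ e) ℕ.+ - (c ℕ.* coeff B e) ≡⟨ ≡.cong (λ i → coeff P i ℕ.+ - (c ℕ.* coeff B e)) s+e≡n ⟩
      coeff P n ℕ.+ - (c ℕ.* coeff B e)         ≈⟨ +-congˡ (coeff P n) (*-congˡ (pred p) cB[e]≈P[n]) ⟩
      coeff P n ℕ.+ - coeff P n                 ≈⟨ +-inverseʳ (coeff P n) ⟩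
      0                                         ∎
      where open ≈-Reasoning

  divMod : ∀ {e B} → HasDegree e B → ∀ n P → DegreeBelow n P →
           ∃₂ λ Q R → P ≈ₚ Q *ₚ B +ₚ R × DegreeBelow e R
  divMod B-deg zero    P deg<0 = [] , P , ≈ₚ-refl , degreeBelow-mono {P = P} z≤n deg<0
  divMod {e} {B} B-deg (suc n) P deg< with suc n ≤? e
  ... | yes n<e = [] , P , ≈ₚ-refl , degreeBelow-mono {P = P} n<e deg<
  ... | no  n≮e =
    let Q , R , P-MB≈QB+R , deg<R = divMod B-deg n (P +ₚ -ₚ (M *ₚ B))
                                      (degreeBelow-cancel {c = c} {B = B} {P = P} (proj₂ B-deg) e≤n deg< lead)
    in  Q +ₚ M , R , absorb {Q} {R} (x-y≈z⇒x≈z+y {P} {M *ₚ B} P-MB≈QB+R) , deg<R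
    where
    e≤n : e ≤ n
    e≤n = ≤-pred (≰⇒> n≮e)
    b⁻¹ = proj₁ (inverse (proj₁ B-deg))
    c = coeff P n ℕ.* b⁻¹
    M = monomial (n ∸ e) c
    lead : c ℕ.* coeff B e ≈ coeff P n
    lead = begin
      coeff P n ℕ.* b⁻¹ ℕ.* coeff B e   ≡⟨ *-assoc (coeff P n) b⁻¹ (coeff B e) ⟩
      coeff P n ℕ.* (b⁻¹ ℕ.* coeff B e) ≈⟨ *-congˡ (coeff P n) (proj₂ (inverse (proj₁ B-deg))) ⟩
      coeff P n ℕ.* 1                   ≡⟨ *-identityʳ (coeff P n) ⟩
      coeff P n                         ∎
      where open ≈-Reasoning
    absorb : ∀ {Q R} → P ≈ₚ (Q *ₚ B +ₚ R) +ₚ M *ₚ B → P ≈ₚ (Q +ₚ M) *ₚ B +ₚ R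
    absorb {Q} {R} P≈QB+R+MB = ≈ₚ-trans P≈QB+R+MB (rearrange Q B R M)
      where
      rearrange : ∀ Q B R M → (Q *ₚ B +ₚ R) +ₚ M *ₚ B ≈ₚ (Q +ₚ M) *ₚ B +ₚ R
      rearrange = solve-∀ polySolverRing

  multiple-divMod : ∀ {t g h G} → HasDegree t h → g *ₚ h ≈ₚ G →
                    ∀ Y → ∃₂ λ Q R → Y *ₚ g ≈ₚ R *ₚ g +ₚ Q *ₚ G × DegreeBelow t R
  multiple-divMod {g = g} {h} {G} h-deg gh≈G Y =
    let Q , R , Y≈Qh+R , deg<R = divMod h-deg (length Y) Y (degreeBelow-length Y)
    in  Q , R , (begin
          Y *ₚ g                 ≈⟨ *ₚ-congʳ g Y≈Qh+R ⟩
          (Q *ₚ h +ₚ R) *ₚ g     ≈⟨ rearrange Q h R g ⟩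
          R *ₚ g +ₚ Q *ₚ (g *ₚ h) ≈⟨ +ₚ-cong ≈ₚ-refl (*ₚ-congˡ Q gh≈G) ⟩
          R *ₚ g +ₚ Q *ₚ G       ∎) , deg<R
    where
    open ≈ₚ-Reasoning
    rearrange : ∀ Q h R g → (Q *ₚ h +ₚ R) *ₚ g ≈ₚ R *ₚ g +ₚ Q *ₚ (g *ₚ h)
    rearrange = solve-∀ polySolverRing

  infix 4 _∣ₚ_ _∈⟨_,_⟩

  record _∣ₚ_ (D P : List ℕ) : Set where
    constructor divides
    field
      quotient : List ℕ
      equation : D *ₚ quotient ≈ₚ P

  ∣ₚ-refl : ∀ D → D ∣ₚ D
  ∣ₚ-refl D = divides (1 ∷ []) (≈ₚ-trans (*ₚ-comm D (1 ∷ [])) (*ₚ-identityˡ D))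

  ∣ₚ[] : ∀ D → D ∣ₚ []
  ∣ₚ[] D = divides [] (*ₚ-zeroʳ D)

  ∣ₚ-cong : ∀ {D P Q} → P ≈ₚ Q → D ∣ₚ P → D ∣ₚ Q
  ∣ₚ-cong P≈Q (divides W DW≈P) = divides W (≈ₚ-trans DW≈P P≈Q)

  ∣ₚ-+ₚ : ∀ {D P Q} → D ∣ₚ P → D ∣ₚ Q → D ∣ₚ P +ₚ Q
  ∣ₚ-+ₚ {D} (divides V DV≈P) (divides W DW≈Q) =
    divides (V +ₚ W) (≈ₚ-trans (*ₚ-distribˡ D V W) (+ₚ-cong DV≈P DW≈Q))
    where
    *ₚ-distribˡ : ∀ D V W → D *ₚ (V +ₚ W) ≈ₚ D *ₚ V +ₚ D *ₚ W
    *ₚ-distribˡ = solve-∀ polySolverRing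

  ∣ₚ-*ₚ : ∀ {D P} Q → D ∣ₚ P → D ∣ₚ Q *ₚ P
  ∣ₚ-*ₚ {D} Q (divides W DW≈P) = divides (Q *ₚ W) (≈ₚ-trans (commute D Q W) (*ₚ-congˡ Q DW≈P))
    where
    commute : ∀ D Q W → D *ₚ (Q *ₚ W) ≈ₚ Q *ₚ (D *ₚ W)
    commute = solve-∀ polySolverRing

  record _∈⟨_,_⟩ (R F G : List ℕ) : Set where
    constructor combination
    field
      coeffˡ coeffʳ : List ℕ
      equation      : R ≈ₚ coeffˡ *ₚ F +ₚ coeffʳ *ₚ G

  ∈⟨⟩-cong : ∀ {F G R S} → R ≈ₚ S → R ∈⟨ F , G ⟩ → S ∈⟨ F , G ⟩
  ∈⟨⟩-cong R≈S (combination U V R≈) = combination U V (≈ₚ-trans (≈ₚ-sym R≈S) R≈)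

  ∈⟨⟩-+ₚ : ∀ {F G R S} → R ∈⟨ F , G ⟩ → S ∈⟨ F , G ⟩ → R +ₚ S ∈⟨ F , G ⟩
  ∈⟨⟩-+ₚ {F} {G} (combination U V R≈) (combination U′ V′ S≈) =
    combination (U +ₚ U′) (V +ₚ V′) (≈ₚ-trans (+ₚ-cong R≈ S≈) (collect U V U′ V′ F G))
    where
    collect : ∀ U V U′ V′ F G →
              (U *ₚ F +ₚ V *ₚ G) +ₚ (U′ *ₚ F +ₚ V′ *ₚ G) ≈ₚ (U +ₚ U′) *ₚ F +ₚ (V +ₚ V′) *ₚ G
    collect = solve-∀ polySolverRing

  ∈⟨⟩-*ₚ : ∀ {F G R} W → R ∈⟨ F , G ⟩ → W *ₚ R ∈⟨ F , G ⟩
  ∈⟨⟩-*ₚ {F} {G} W (combination U V R≈) =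
    combination (W *ₚ U) (W *ₚ V) (≈ₚ-trans (*ₚ-congˡ W R≈) (distribute W U V F G))
    where
    distribute : ∀ W U V F G → W *ₚ (U *ₚ F +ₚ V *ₚ G) ≈ₚ (W *ₚ U) *ₚ F +ₚ (W *ₚ V) *ₚ G
    distribute = solve-∀ polySolverRing

  ∈⟨⟩-left : ∀ F G → F ∈⟨ F , G ⟩
  ∈⟨⟩-left F G = combination (1 ∷ []) [] (≈ₚ-sym (≈ₚ-trans (+ₚ-identityʳ _) (*ₚ-identityˡ F)))

  ∈⟨⟩-right : ∀ F G → G ∈⟨ F , G ⟩
  ∈⟨⟩-right F G = combination [] (1 ∷ []) (≈ₚ-sym (*ₚ-identityˡ G))

  euclid : ∀ {F G} n R₀ R₁ → R₀ ∈⟨ F , G ⟩ → R₁ ∈⟨ F , G ⟩ → DegreeBelow n R₁ →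
           ∃ λ D → D ∈⟨ F , G ⟩ × D ∣ₚ R₀ × D ∣ₚ R₁
  euclid n R₀ R₁ R₀∈ R₁∈ deg<R₁ with ≈ₚ[]⊎hasDegree n deg<R₁
  ... | inj₁ R₁≈0 = R₀ , R₀∈ , ∣ₚ-refl R₀ , ∣ₚ-cong (≈ₚ-sym R₁≈0) (∣ₚ[] R₀)
  euclid (suc n) R₀ R₁ R₀∈ R₁∈ _ | inj₂ (d , s≤s d≤n , R₁-deg) =
    let Q , R₂ , R₀≈QR₁+R₂ , deg<R₂ = divMod R₁-deg (length R₀) R₀ (degreeBelow-length R₀)
        R₂∈ = ∈⟨⟩-cong (≈ₚ-sym (x≈y+z⇒z≈x-y R₀≈QR₁+R₂))
                       (∈⟨⟩-+ₚ R₀∈ (∈⟨⟩-*ₚ (- 1 ∷ []) (∈⟨⟩-*ₚ Q R₁∈)))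
        D , D∈ , D∣R₁ , D∣R₂ = euclid n R₁ R₂ R₁∈ R₂∈ (degreeBelow-mono {P = R₂} d≤n deg<R₂)
    in  D , D∈ , ∣ₚ-cong (≈ₚ-sym R₀≈QR₁+R₂) (∣ₚ-+ₚ (∣ₚ-*ₚ Q D∣R₁) D∣R₂) , D∣R₁

  gcd-∈⟨⟩ : ∀ {n F G D} → DegreeBelow n F → (∀ E → E ∣ₚ F → E ∣ₚ G → E ∣ₚ D) → D ∈⟨ F , G ⟩
  gcd-∈⟨⟩ {n} {F} {G} deg<F greatest =
    let E , E∈ , E∣G , E∣F = euclid n G F (∈⟨⟩-right F G) (∈⟨⟩-left F G) deg<F
        divides W EW≈D = greatest E E∣F E∣G
    in  ∈⟨⟩-cong (≈ₚ-trans (*ₚ-comm W E) EW≈D) (∈⟨⟩-*ₚ W E∈)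

  coeff≗ : ∀ P n → coeff P n ≡ Defs.coeff P n
  coeff≗ []      n       = ≡.refl
  coeff≗ (a ∷ P) zero    = ≡.refl
  coeff≗ (a ∷ P) (suc n) = coeff≗ P n

  private
    map-applyUpTo : ∀ (f g : ℕ → ℕ) n → map f (applyUpTo g n) ≡ applyUpTo (f ∘ g) n
    map-applyUpTo f g zero    = ≡.refl
    map-applyUpTo f g (suc n) = ≡.cong (f (g 0) ∷_) (map-applyUpTo f (g ∘ suc) n)

    sum-applyUpTo-0 : ∀ n → sum (applyUpTo (λ _ → 0) n) ≡ 0
    sum-applyUpTo-0 zero    = ≡.refl
    sum-applyUpTo-0 (suc n) = sum-applyUpTo-0 n

  mulCoeff≈coeff-*ₚ : ∀ P Q n → Defs.mulCoeff P Q n ≈ coeff (P *ₚ Q) n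
  mulCoeff≈coeff-*ₚ []      Q n =
    ≡⇒≈ (≡.trans (≡.cong sum (map-applyUpTo (λ i → Defs.coeff [] i ℕ.* Defs.coeff Q (n ∸ i)) (λ i → i) (suc n)))
                 (sum-applyUpTo-0 (suc n)))
  mulCoeff≈coeff-*ₚ (a ∷ P) Q zero = begin
    a ℕ.* Defs.coeff Q 0 ℕ.+ 0      ≡⟨ ≡.cong (λ x → a ℕ.* x ℕ.+ 0) (coeff≗ Q 0) ⟨
    a ℕ.* coeff Q 0 ℕ.+ 0           ≈⟨ coeff-*ₚ a P Q 0 ⟨
    coeff ((a ∷ P) *ₚ Q) 0          ∎
    where open ≈-Reasoning
  mulCoeff≈coeff-*ₚ (a ∷ P) Q (suc n) = begin
    a ℕ.* Defs.coeff Q (suc n) ℕ.+ sum (map F (applyUpTo suc (suc n)))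
      ≡⟨ ≡.cong₂ (λ x y → a ℕ.* x ℕ.+ y) (≡.sym (coeff≗ Q (suc n))) shift ⟩
    a ℕ.* coeff Q (suc n) ℕ.+ Defs.mulCoeff P Q n
      ≈⟨ +-congˡ (a ℕ.* coeff Q (suc n)) (mulCoeff≈coeff-*ₚ P Q n) ⟩
    a ℕ.* coeff Q (suc n) ℕ.+ coeff (P *ₚ Q) n
      ≈⟨ coeff-*ₚ a P Q (suc n) ⟨
    coeff ((a ∷ P) *ₚ Q) (suc n)
      ∎
    where
    open ≈-Reasoning
    F : ℕ → ℕ
    F i = Defs.coeff (a ∷ P) i ℕ.* Defs.coeff Q (suc n ∸ i)
    shift : sum (map F (applyUpTo suc (suc n))) ≡ Defs.mulCoeff P Q n
    shift = ≡.cong sum (≡.trans (map-applyUpTo F suc (suc n)) (≡.sym (map-applyUpTo (F ∘ suc) (λ i → i) (suc n))))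

  PDiv⇒∣ₚ : ∀ {D P} → Defs.PDiv p D P → D ∣ₚ P
  PDiv⇒∣ₚ {D} {P} (W , DW≡P) = divides W (mk≈ₚ λ n →
    ≈-trans (≈-sym (mulCoeff≈coeff-*ₚ D W n)) (≈-trans (Cong⇒≈ (DW≡P n)) (≡⇒≈ (≡.sym (coeff≗ P n)))))

  ∣ₚ⇒PDiv : ∀ {D P} → D ∣ₚ P → Defs.PDiv p D P
  ∣ₚ⇒PDiv {D} {P} (divides W DW≈P) = W , λ n →
    ≈⇒Cong (≈-trans (mulCoeff≈coeff-*ₚ D W n) (≈-trans (coeff-≈ DW≈P n) (≡⇒≈ (coeff≗ P n))))

  PDegree⇒HasDegree : ∀ {d P} → Defs.PDegree p P d → HasDegree d P
  PDegree⇒HasDegree {d} {P} (P[d]≢0 , P[>d]≡0) =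
    (λ P[d]≈0 → P[d]≢0 (≈⇒Cong (≈-trans (≡⇒≈ (≡.sym (coeff≗ P d))) P[d]≈0))) ,
    (λ i d<i → ≈-trans (≡⇒≈ (coeff≗ P i)) (Cong⇒≈ (P[>d]≡0 i d<i)))

module ReductionModXᵏ-1 (p : ℕ) (p-prime : Prime p) (m : ℕ) where
  open import Data.Nat as ℕ using (zero; _+_; _*_; _<_; pred; z≤n; s≤s)
  open import Data.Nat.Properties
    using ( ≤-refl; m≤n⇒m≤1+n; +-comm; +-identityʳ; m+[n∸m]≡n; m∸n+n≡m; +-commutativeSemigroup
          ; *-zeroʳ; *-identityˡ; *-distribˡ-+ )
  open import Data.Nat.GeneralisedArithmetic using (iterate)
  open import Data.List using (List; []; _∷_)
  open import Data.Product using (proj₁; proj₂)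
  open import Relation.Binary.PropositionalEquality as ≡ using (_≡_)
  open import Algebra.Properties.CommutativeSemigroup +-commutativeSemigroup using (interchange)

  open PolynomialOverPrimeField p p-prime

  k : ℕ
  k = suc m

  xᵏ-1 : List ℕ
  xᵏ-1 = xk-1 p k

  predₖ : ℕ → ℕ
  predₖ zero    = m
  predₖ (suc i) = i

  -- For i < k, wrap P i is the coefficient of xⁱ in P reduced modulo xᵏ − 1: the sum of the
  -- coefficients of P at the exponents congruent to i modulo k.
  wrap : List ℕ → ℕ → ℕ
  wrap []      _       = 0
  wrap (c ∷ P) zero    = c + wrap P m
  wrap (c ∷ P) (suc i) = wrap P i

  wrap-+ₚ : ∀ P Q i → wrap (P +ₚ Q) i ≡ wrap P i + wrap Q i
  wrap-+ₚ []      Q       i       = ≡.refl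
  wrap-+ₚ (c ∷ P) []      i       = ≡.sym (+-identityʳ _)
  wrap-+ₚ (c ∷ P) (d ∷ Q) zero    = ≡.trans (≡.cong (c + d +_) (wrap-+ₚ P Q m)) (interchange c d _ _)
  wrap-+ₚ (c ∷ P) (d ∷ Q) (suc i) = wrap-+ₚ P Q i

  wrap-· : ∀ c P i → wrap (c · P) i ≡ c * wrap P i
  wrap-· c []      i       = ≡.sym (*-zeroʳ c)
  wrap-· c (d ∷ P) zero    = ≡.trans (≡.cong (c * d +_) (wrap-· c P m)) (≡.sym (*-distribˡ-+ c d _))
  wrap-· c (d ∷ P) (suc i) = wrap-· c P i

  wrap-≈[] : ∀ {P} → P ≈ₚ [] → ∀ i → wrap P i ≈ 0
  wrap-≈[] {[]}    P≈0 i       = ≈-refl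
  wrap-≈[] {c ∷ P} cP≈0 zero    = +-cong (proj₁ (∷-≈[] cP≈0)) (wrap-≈[] (proj₂ (∷-≈[] cP≈0)) m)
  wrap-≈[] {c ∷ P} cP≈0 (suc i) = wrap-≈[] (proj₂ (∷-≈[] cP≈0)) i

  wrap-cong : ∀ {P Q} → P ≈ₚ Q → ∀ i → wrap P i ≈ wrap Q i
  wrap-cong {[]}    {Q}     P≈Q i       = ≈-sym (wrap-≈[] (≈ₚ-sym P≈Q) i)
  wrap-cong {c ∷ P} {[]}    P≈Q i       = wrap-≈[] P≈Q i
  wrap-cong {c ∷ P} {d ∷ Q} P≈Q zero    = +-cong (coeff-≈ P≈Q 0) (wrap-cong (∷-injectiveʳ P≈Q) m)
  wrap-cong {c ∷ P} {d ∷ Q} P≈Q (suc i) = wrap-cong (∷-injectiveʳ P≈Q) i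

  wrap-degreeBelow : ∀ n P → n ≤ k → DegreeBelow n P → ∀ i → i < k → wrap P i ≈ coeff P i
  wrap-degreeBelow zero    P       _         deg<0 i _ =
    ≈-trans (wrap-≈[] (degreeBelow-zero {P} deg<0) i) (≈-sym (deg<0 i z≤n))
  wrap-degreeBelow (suc n) []      _         _     i _ = ≈-refl
  wrap-degreeBelow (suc n) (c ∷ P) (s≤s n≤m) deg< zero _ = begin
    c + wrap P m          ≈⟨ +-congˡ c (wrap-degreeBelow n P (m≤n⇒m≤1+n n≤m) deg<P m ≤-refl) ⟩
    c + coeff P m         ≈⟨ +-congˡ c (deg<P m n≤m) ⟩
    c + 0                 ≡⟨ +-identityʳ c ⟩
    c                     ∎
    where
    open ≈-Reasoning
    deg<P : DegreeBelow n P
    deg<P = degreeBelow-tail {a = c} deg<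
  wrap-degreeBelow (suc n) (c ∷ P) (s≤s n≤m) deg< (suc i) (s≤s i<m) =
    wrap-degreeBelow n P (m≤n⇒m≤1+n n≤m) (degreeBelow-tail {a = c} deg<) i (m≤n⇒m≤1+n i<m)

  wrap-0∷ : ∀ P i → wrap (0 ∷ P) i ≡ wrap P (predₖ i)
  wrap-0∷ P zero    = ≡.refl
  wrap-0∷ P (suc i) = ≡.refl

  wrap-monomial-*ₚ : ∀ j Q i → wrap (monomial j 1 *ₚ Q) i ≡ wrap Q (iterate predₖ i j)
  wrap-monomial-*ₚ zero    Q i = begin
    wrap (1 · Q +ₚ (0 ∷ [])) i      ≡⟨ wrap-+ₚ (1 · Q) (0 ∷ []) i ⟩
    wrap (1 · Q) i + wrap (0 ∷ []) i ≡⟨ ≡.cong₂ _+_ (wrap-· 1 Q i) (wrap-0∷ [] i) ⟩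
    1 * wrap Q i + 0                ≡⟨ ≡.trans (+-identityʳ _) (*-identityˡ _) ⟩
    wrap Q i                        ∎
    where open ≡.≡-Reasoning
  wrap-monomial-*ₚ (suc j) Q i = begin
    wrap (0 · Q +ₚ (0 ∷ monomial j 1 *ₚ Q)) i       ≡⟨ wrap-+ₚ (0 · Q) _ i ⟩
    wrap (0 · Q) i + wrap (0 ∷ monomial j 1 *ₚ Q) i ≡⟨ ≡.cong₂ _+_ (wrap-· 0 Q i) (wrap-0∷ _ i) ⟩
    wrap (monomial j 1 *ₚ Q) (predₖ i)              ≡⟨ wrap-monomial-*ₚ j Q (predₖ i) ⟩
    wrap Q (iterate predₖ (predₖ i) j)              ∎
    where open ≡.≡-Reasoning

  iterate-+ : ∀ {A : Set} (f : A → A) x a b → iterate f x (a + b) ≡ iterate f (iterate f x a) b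
  iterate-+ f x zero    b = ≡.refl
  iterate-+ f x (suc a) b = iterate-+ f (f x) a b

  iterate-predₖ-down : ∀ j s → iterate predₖ (j + s) j ≡ s
  iterate-predₖ-down zero    s = ≡.refl
  iterate-predₖ-down (suc j) s = iterate-predₖ-down j s

  iterate-predₖ-k : ∀ i → i < k → iterate predₖ i k ≡ i
  iterate-predₖ-k i (s≤s i≤m) = begin
    iterate predₖ i k                                ≡⟨ ≡.cong (iterate predₖ i) k≡i+1+[m∸i] ⟩
    iterate predₖ i ((i + 1) + (m ∸ i))              ≡⟨ iterate-+ predₖ i (i + 1) (m ∸ i) ⟩
    iterate predₖ (iterate predₖ i (i + 1)) (m ∸ i)  ≡⟨ ≡.cong (λ x → iterate predₖ x (m ∸ i)) i+1-steps ⟩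
    iterate predₖ m (m ∸ i)                          ≡⟨ ≡.cong (λ x → iterate predₖ x (m ∸ i)) (m∸n+n≡m i≤m) ⟨
    iterate predₖ ((m ∸ i) + i) (m ∸ i)              ≡⟨ iterate-predₖ-down (m ∸ i) i ⟩
    i                                                ∎
    where
    open ≡.≡-Reasoning
    k≡i+1+[m∸i] : k ≡ (i + 1) + (m ∸ i)
    k≡i+1+[m∸i] = ≡.trans (≡.cong suc (≡.sym (m+[n∸m]≡n i≤m))) (≡.cong (_+ (m ∸ i)) (+-comm 1 i))
    i+1-steps : iterate predₖ i (i + 1) ≡ m
    i+1-steps = begin
      iterate predₖ i (i + 1)                 ≡⟨ iterate-+ predₖ i i 1 ⟩
      predₖ (iterate predₖ i i)               ≡⟨ ≡.cong (λ x → predₖ (iterate predₖ x i)) (+-identityʳ i) ⟨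
      predₖ (iterate predₖ (i + 0) i)         ≡⟨ ≡.cong predₖ (iterate-predₖ-down i 0) ⟩
      m                                       ∎

  wrap-xᵏ-1 : ∀ Q i → i < k → wrap (xᵏ-1 *ₚ Q) i ≈ 0
  wrap-xᵏ-1 Q i i<k = begin
    wrap (pred p · Q +ₚ (0 ∷ monomial m 1 *ₚ Q)) i           ≡⟨ wrap-+ₚ (pred p · Q) _ i ⟩
    wrap (pred p · Q) i + wrap (0 ∷ monomial m 1 *ₚ Q) i     ≡⟨ ≡.cong₂ _+_ (wrap-· (pred p) Q i)
                                                                  (≡.trans (wrap-0∷ _ i) (wrap-monomial-*ₚ m Q (predₖ i))) ⟩
    - wrap Q i + wrap Q (iterate predₖ i k)                  ≡⟨ ≡.cong (λ j → - wrap Q i + wrap Q j) (iterate-predₖ-k i i<k) ⟩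
    - wrap Q i + wrap Q i                                    ≡⟨ +-comm (- wrap Q i) (wrap Q i) ⟩
    wrap Q i + - wrap Q i                                    ≈⟨ +-inverseʳ (wrap Q i) ⟩
    0                                                        ∎
    where open ≈-Reasoning

module Circulant (p : ℕ) (p-prime : Prime p) (m : ℕ) (a : Fin (suc m) → ℕ) where
  open import Data.Nat as ℕ using (zero; _+_; _*_; _%_; _<_; z≤n; s≤s)
  open import Data.Nat.Properties
    using (≤-refl; ≤-trans; n≤1+n; +-comm; +-assoc; *-distribʳ-+; +-∸-comm; m+n∸m≡n; m+n∸n≡m; +-suc)
  open import Data.Nat.DivMod using (_mod_; [m+n]%n≡m%n; m<n⇒m%n≡m; m%n<n)
  open import Data.List using (List; []; _∷_; tabulate)
  open import Data.Fin as Fin using (toℕ)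
  open import Data.Fin.Properties using (toℕ-fromℕ<; toℕ<n)
  open import Data.Product using (∃; _,_)
  open import Function using (_∘_)
  open import Relation.Binary.PropositionalEquality as ≡ using (_≡_)

  open PolynomialOverPrimeField p p-prime
  open ReductionModXᵏ-1 p p-prime m

  f : List ℕ
  f = gonPoly a

  sumBelow : ℕ → (ℕ → ℕ) → ℕ
  sumBelow zero    H = 0
  sumBelow (suc n) H = H 0 + sumBelow n (H ∘ suc)

  sumBelow-cong : ∀ n {G H} → (∀ j → j < n → G j ≡ H j) → sumBelow n G ≡ sumBelow n H
  sumBelow-cong zero    G≡H = ≡.refl
  sumBelow-cong (suc n) G≡H = ≡.cong₂ _+_ (G≡H 0 (s≤s z≤n)) (sumBelow-cong n (λ j j<n → G≡H (suc j) (s≤s j<n)))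

  sumBelow-cong≈ : ∀ n {G H} → (∀ j → j < n → G j ≈ H j) → sumBelow n G ≈ sumBelow n H
  sumBelow-cong≈ zero    G≈H = ≈-refl
  sumBelow-cong≈ (suc n) G≈H = +-cong (G≈H 0 (s≤s z≤n)) (sumBelow-cong≈ n (λ j j<n → G≈H (suc j) (s≤s j<n)))

  sumBelow-0 : ∀ n → sumBelow n (λ _ → 0) ≡ 0
  sumBelow-0 zero    = ≡.refl
  sumBelow-0 (suc n) = sumBelow-0 n

  sumBelow-last : ∀ n H → sumBelow (suc n) H ≡ sumBelow n H + H n
  sumBelow-last zero    H = +-comm (H 0) 0
  sumBelow-last (suc n) H = ≡.trans (≡.cong (H 0 +_) (sumBelow-last n (H ∘ suc))) (≡.sym (+-assoc (H 0) _ _))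

  sumBelow-rotate : ∀ H → sumBelow k (H ∘ predₖ) ≡ sumBelow k H
  sumBelow-rotate H = ≡.trans (+-comm (H m) (sumBelow m H)) (≡.sym (sumBelow-last m H))

  sumFin≡sumBelow : ∀ {n} (F : Fin n → ℕ) H → (∀ i → F i ≡ H (toℕ i)) → sumFin F ≡ sumBelow n H
  sumFin≡sumBelow {zero}  F H F≡H = ≡.refl
  sumFin≡sumBelow {suc n} F H F≡H =
    ≡.cong₂ _+_ (F≡H Fin.zero) (sumFin≡sumBelow (F ∘ Fin.suc) (H ∘ suc) (F≡H ∘ Fin.suc))

  index : ℕ → ℕ → ℕ
  index i j = (i + k ∸ j) % k

  index-zero : ∀ {i} → i < k → index i 0 ≡ i
  index-zero {i} i<k = ≡.trans ([m+n]%n≡m%n i k) (m<n⇒m%n≡m i<k)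

  index-predₖ : ∀ i j → j < k → index i j ≡ index (predₖ i) (predₖ j)
  index-predₖ zero    zero    _         = ≡.cong (_% k) (≡.sym (m+n∸m≡n m k))
  index-predₖ zero    (suc j) (s≤s j<m) = ≡.sym (≡.trans (≡.cong (_% k) (+-∸-comm {m} k (≤-trans (n≤1+n j) j<m)))
                                                          ([m+n]%n≡m%n (m ∸ j) k))
  index-predₖ (suc i) zero    _         = ≡.trans ([m+n]%n≡m%n (suc i) k)
                                                  (≡.cong (_% k) (≡.sym (≡.trans (≡.cong (_∸ m) (+-suc i m))
                                                                                 (m+n∸n≡m (suc i) m))))
  index-predₖ (suc i) (suc j) _         = ≡.refl

  predₖ<k : ∀ {i} → i < k → predₖ i < k
  predₖ<k {zero}  _   = ≤-refl
  predₖ<k {suc i} i<k = ≤-trans (n≤1+n _) i<k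

  circulant : (ℕ → ℕ) → ℕ → ℕ
  circulant V i = sumBelow k (λ j → V j * coeff f (index i j))

  circulant-wrap : ∀ W i → i < k → circulant (wrap W) i ≈ wrap (W *ₚ f) i
  circulant-wrap []      i _   = ≡⇒≈ (sumBelow-0 k)
  circulant-wrap (c ∷ W) i i<k = begin
    circulant (wrap (c ∷ W)) i
      ≡⟨ ≡.trans (≡.cong (_+ sumBelow m (λ j → wrap W j * coeff f (index i (suc j))))
                         (*-distribʳ-+ (coeff f (index i 0)) c (wrap W m)))
                 (+-assoc (c * coeff f (index i 0)) _ _) ⟩
    c * coeff f (index i 0) + sumBelow k (λ j → wrap W (predₖ j) * coeff f (index i j))
      ≡⟨ ≡.cong₂ _+_ (≡.cong (λ j → c * coeff f j) (index-zero i<k)) rotate ⟩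
    c * coeff f i + circulant (wrap W) (predₖ i)
      ≈⟨ +-cong (*-congˡ c (≈-sym (wrap-degreeBelow k f ≤-refl (degreeBelow-tabulate a) i i<k)))
                (circulant-wrap W (predₖ i) (predₖ<k i<k)) ⟩
    c * wrap f i + wrap (W *ₚ f) (predₖ i)
      ≡⟨ ≡.cong₂ _+_ (wrap-· c f i) (wrap-0∷ (W *ₚ f) i) ⟨
    wrap (c · f) i + wrap (0 ∷ W *ₚ f) i
      ≡⟨ wrap-+ₚ (c · f) (0 ∷ W *ₚ f) i ⟨
    wrap ((c ∷ W) *ₚ f) i
      ∎
    where
    open ≈-Reasoning
    rotate : sumBelow k (λ j → wrap W (predₖ j) * coeff f (index i j)) ≡ circulant (wrap W) (predₖ i)
    rotate = ≡.trans (sumBelow-cong k (λ j j<k → ≡.cong (λ x → wrap W (predₖ j) * coeff f x) (index-predₖ i j j<k)))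
                     (sumBelow-rotate (λ j → wrap W j * coeff f (index (predₖ i) j)))

  circ≡coeff-index : ∀ i j → circ a i j ≡ coeff f (index (toℕ i) (toℕ j))
  circ≡coeff-index i j = ≡.sym (≡.trans (≡.cong (coeff f) (≡.sym (toℕ-fromℕ< (m%n<n (toℕ i + k ∸ toℕ j) k))))
                                        (coeff-tabulate a ((toℕ i + k ∸ toℕ j) mod k)))

  sumFin-circ : ∀ (c : Fin k → ℕ) V → (∀ j → c j ≡ V (toℕ j)) →
                ∀ i → sumFin (λ j → c j * circ a i j) ≡ circulant V (toℕ i)
  sumFin-circ c V c≡V i =
    sumFin≡sumBelow _ (λ j → V j * coeff f (index (toℕ i) j)) (λ j → ≡.cong₂ _*_ (c≡V j) (circ≡coeff-index i j))

  InN-cong : ∀ {u v} → VecCong p u v → InN p a u → InN p a v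
  InN-cong u≡v (c , u≡Cc) = c , λ i → ≈⇒Cong (≈-trans (≈-sym (Cong⇒≈ (u≡v i))) (Cong⇒≈ (u≡Cc i)))

  wrap-*ₚf∈N : ∀ W → InN p a (λ i → wrap (W *ₚ f) (toℕ i))
  wrap-*ₚf∈N W = (λ j → wrap W (toℕ j)) , λ i → ≈⇒Cong (begin
    wrap (W *ₚ f) (toℕ i)                               ≈⟨ circulant-wrap W (toℕ i) (toℕ<n i) ⟨
    circulant (wrap W) (toℕ i)                          ≡⟨ sumFin-circ _ (wrap W) (λ _ → ≡.refl) i ⟨
    sumFin (λ j → wrap W (toℕ j) * circ a i j)          ∎)
    where open ≈-Reasoning

  N⊆wrap-*ₚf : ∀ {v} → InN p a v → ∃ λ W → ∀ i → v i ≈ wrap (W *ₚ f) (toℕ i)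
  N⊆wrap-*ₚf {v} (c , v≡Cc) = tabulate c , λ i → begin
    v i                                      ≈⟨ Cong⇒≈ (v≡Cc i) ⟩
    sumFin (λ j → c j * circ a i j)          ≡⟨ sumFin-circ c (coeff (tabulate c)) (λ j → ≡.sym (coeff-tabulate c j)) i ⟩
    circulant (coeff (tabulate c)) (toℕ i)   ≈⟨ sumBelow-cong≈ k (λ j j<k →
                                                  *-congʳ (coeff f (index (toℕ i) j)) (≈-sym (wrap-below j j<k))) ⟩
    circulant (wrap (tabulate c)) (toℕ i)    ≈⟨ circulant-wrap (tabulate c) (toℕ i) (toℕ<n i) ⟩
    wrap (tabulate c *ₚ f) (toℕ i)           ∎
    where
    open ≈-Reasoning
    wrap-below : ∀ j → j < k → wrap (tabulate c) j ≈ coeff (tabulate c) j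
    wrap-below = wrap-degreeBelow k (tabulate c) ≤-refl (degreeBelow-tabulate c)

module CirculantIdeal (p : ℕ) (p-prime : Prime p) (m : ℕ) (a : Fin (suc m) → ℕ) where
  open import Data.Nat as ℕ using (_+_; _<_)
  open import Data.Nat.Properties using (≤-refl; m+n∸m≡n; +-comm; +-identityʳ)
  open import Data.List using (length; tabulate)
  open import Data.Fin using (toℕ; fromℕ<)
  open import Data.Fin.Properties using (toℕ-fromℕ<; toℕ<n)
  open import Data.Product using (∃; ∃₂; _×_; _,_; proj₁; proj₂)
  open import Data.Sum using (inj₁; inj₂)
  open import Data.Empty using (⊥-elim)
  open import Relation.Binary.PropositionalEquality as ≡ using (_≡_)

  open PolynomialOverPrimeField p p-prime
  open ReductionModXᵏ-1 p p-prime m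
  open Circulant p p-prime m a

  xᵏ-1-hasDegree : HasDegree k xᵏ-1
  xᵏ-1-hasDegree = ∷-hasDegree (monomial-hasDegree m 1≉0)

  cofactor-hasDegree : ∀ {d g h} → HasDegree d g → g *ₚ h ≈ₚ xᵏ-1 → ∃ λ t → d + t ≡ k × HasDegree t h
  cofactor-hasDegree {d} {g} {h} g-deg gh≈xᵏ-1 with ≈ₚ[]⊎hasDegree (length h) (degreeBelow-length h)
  ... | inj₁ h≈0 = ⊥-elim (proj₁ xᵏ-1-hasDegree (≈-trans (≈-sym (coeff-≈ gh≈xᵏ-1 k))
                                                     (coeff-≈ (≈ₚ-trans (*ₚ-congˡ g h≈0) (*ₚ-zeroʳ g)) k)))
  ... | inj₂ (t , _ , h-deg) =
    t , hasDegree-unique {P = xᵏ-1} (hasDegree-cong gh≈xᵏ-1 (*ₚ-hasDegree {P = g} {Q = h} g-deg h-deg)) xᵏ-1-hasDegree , h-deg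

  wrap-+ₚ-xᵏ-1 : ∀ P Q i → i < k → wrap (P +ₚ Q *ₚ xᵏ-1) i ≈ wrap P i
  wrap-+ₚ-xᵏ-1 P Q i i<k = begin
    wrap (P +ₚ Q *ₚ xᵏ-1) i          ≡⟨ wrap-+ₚ P (Q *ₚ xᵏ-1) i ⟩
    wrap P i + wrap (Q *ₚ xᵏ-1) i    ≈⟨ +-congˡ (wrap P i) (≈-trans (wrap-cong (*ₚ-comm Q xᵏ-1) i)
                                                                  (wrap-xᵏ-1 Q i i<k)) ⟩
    wrap P i + 0                     ≡⟨ +-identityʳ (wrap P i) ⟩
    wrap P i                         ∎
    where open ≈-Reasoning

  module Parametrisation
    {d t g h} (d+t≡k : d + t ≡ k) (g-deg : HasDegree d g) (h-deg : HasDegree t h)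
    (g∈ : g ∈⟨ f , xᵏ-1 ⟩) {f′} (gf′≈f : g *ₚ f′ ≈ₚ f) (gh≈xᵏ-1 : g *ₚ h ≈ₚ xᵏ-1) where

    φ : (Fin t → ℕ) → (Fin k → ℕ)
    φ x i = coeff (tabulate x *ₚ g) (toℕ i)

    *ₚg-degreeBelow : ∀ U → DegreeBelow t U → DegreeBelow k (U *ₚ g)
    *ₚg-degreeBelow U deg<U = ≡.subst (λ n → DegreeBelow n (U *ₚ g)) (≡.trans (+-comm t d) d+t≡k)
                                      (*ₚ-degreeBelow t d U g deg<U (proj₂ g-deg))

    coeff≈wrap : ∀ U → DegreeBelow t U → ∀ i → i < k → coeff (U *ₚ g) i ≈ wrap (U *ₚ g) i
    coeff≈wrap U deg<U i i<k = ≈-sym (wrap-degreeBelow k (U *ₚ g) ≤-refl (*ₚg-degreeBelow U deg<U) i i<k)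

    φ-cong : ∀ x y → VecCong p x y → VecCong p (φ x) (φ y)
    φ-cong x y x≡y i = ≈⇒Cong (coeff-≈ (*ₚ-congʳ g (tabulate-cong (λ j → Cong⇒≈ (x≡y j)))) (toℕ i))

    φ-⊕ : ∀ x y → VecCong p (φ (x ⊕ y)) (φ x ⊕ φ y)
    φ-⊕ x y i = ≈⇒Cong (begin
      coeff (tabulate (x ⊕ y) *ₚ g) (toℕ i)                        ≈⟨ coeff-≈ (*ₚ-congʳ g (tabulate-+ x y)) (toℕ i) ⟩
      coeff ((tabulate x +ₚ tabulate y) *ₚ g) (toℕ i)              ≈⟨ coeff-≈ (*ₚ-distribʳ g (tabulate x) (tabulate y)) (toℕ i) ⟩
      coeff (tabulate x *ₚ g +ₚ tabulate y *ₚ g) (toℕ i)           ≈⟨ coeff-+ₚ (tabulate x *ₚ g) (tabulate y *ₚ g) (toℕ i) ⟩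
      coeff (tabulate x *ₚ g) (toℕ i) + coeff (tabulate y *ₚ g) (toℕ i) ∎)
      where open ≈-Reasoning

    φ-injective : ∀ x y → VecCong p (φ x) (φ y) → VecCong p x y
    φ-injective x y φx≡φy j = ≈⇒Cong (begin
      x j                        ≡⟨ coeff-tabulate x j ⟨
      coeff (tabulate x) (toℕ j) ≈⟨ coeff-≈ (*ₚ-cancelʳ {P = tabulate x} {Q = tabulate y} g-deg xg≈yg) (toℕ j) ⟩
      coeff (tabulate y) (toℕ j) ≡⟨ coeff-tabulate y j ⟩
      y j                        ∎)
      where
      open ≈-Reasoning
      agree : ∀ i → i < k → coeff (tabulate x *ₚ g) i ≈ coeff (tabulate y *ₚ g) i
      agree i i<k = ≡.subst (λ i → coeff (tabulate x *ₚ g) i ≈ coeff (tabulate y *ₚ g) i) (toℕ-fromℕ< i<k)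
                            (Cong⇒≈ (φx≡φy (fromℕ< i<k)))
      xg≈yg : tabulate x *ₚ g ≈ₚ tabulate y *ₚ g
      xg≈yg = degreeBelow⇒≈ₚ (*ₚg-degreeBelow (tabulate x) (degreeBelow-tabulate x))
                              (*ₚg-degreeBelow (tabulate y) (degreeBelow-tabulate y)) agree

    φ∈N : ∀ x → InN p a (φ x)
    φ∈N x = combination⇒∈N (∈⟨⟩-*ₚ (tabulate x) g∈)
      where
      combination⇒∈N : tabulate x *ₚ g ∈⟨ f , xᵏ-1 ⟩ → InN p a (φ x)
      combination⇒∈N (combination U V xg≈Uf+Vxᵏ-1) = InN-cong (λ i → ≈⇒Cong (≈-sym (φx≈wrap i))) (wrap-*ₚf∈N U)
        where
        φx≈wrap : ∀ i → φ x i ≈ wrap (U *ₚ f) (toℕ i)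
        φx≈wrap i = begin
          coeff (tabulate x *ₚ g) (toℕ i)    ≈⟨ coeff≈wrap (tabulate x) (degreeBelow-tabulate x) (toℕ i) (toℕ<n i) ⟩
          wrap (tabulate x *ₚ g) (toℕ i)     ≈⟨ wrap-cong xg≈Uf+Vxᵏ-1 (toℕ i) ⟩
          wrap (U *ₚ f +ₚ V *ₚ xᵏ-1) (toℕ i) ≈⟨ wrap-+ₚ-xᵏ-1 (U *ₚ f) V (toℕ i) (toℕ<n i) ⟩
          wrap (U *ₚ f) (toℕ i)              ∎
          where open ≈-Reasoning

    wrap-*ₚf∈φ : ∀ W → ∃ λ x → ∀ i → φ x i ≈ wrap (W *ₚ f) (toℕ i)
    wrap-*ₚf∈φ W = remainder⇒φ (multiple-divMod h-deg gh≈xᵏ-1 (W *ₚ f′))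
      where
      remainder⇒φ : (∃₂ λ Q R → (W *ₚ f′) *ₚ g ≈ₚ R *ₚ g +ₚ Q *ₚ xᵏ-1 × DegreeBelow t R) →
                    ∃ λ x → ∀ i → φ x i ≈ wrap (W *ₚ f) (toℕ i)
      remainder⇒φ (Q , R , Wf′g≈Rg+Qxᵏ-1 , deg<R) = (λ j → coeff R (toℕ j)) , φR≈wrap
        where
        Wf≈Rg+Qxᵏ-1 : W *ₚ f ≈ₚ R *ₚ g +ₚ Q *ₚ xᵏ-1
        Wf≈Rg+Qxᵏ-1 = ≈ₚ-trans (*ₚ-congˡ W (≈ₚ-trans (≈ₚ-sym gf′≈f) (*ₚ-comm g f′)))
                               (≈ₚ-trans (≈ₚ-sym (*ₚ-assoc W f′ g)) Wf′g≈Rg+Qxᵏ-1)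
        φR≈wrap : ∀ i → φ (λ j → coeff R (toℕ j)) i ≈ wrap (W *ₚ f) (toℕ i)
        φR≈wrap i = begin
          φ (λ j → coeff R (toℕ j)) i                         ≈⟨ coeff-≈ (*ₚ-congʳ g (tabulate-coeff t {R} deg<R)) (toℕ i) ⟩
          coeff (R *ₚ g) (toℕ i)                              ≈⟨ coeff≈wrap R deg<R (toℕ i) (toℕ<n i) ⟩
          wrap (R *ₚ g) (toℕ i)                               ≈⟨ wrap-+ₚ-xᵏ-1 (R *ₚ g) Q (toℕ i) (toℕ<n i) ⟨
          wrap (R *ₚ g +ₚ Q *ₚ xᵏ-1) (toℕ i)                  ≈⟨ wrap-cong Wf≈Rg+Qxᵏ-1 (toℕ i) ⟨
          wrap (W *ₚ f) (toℕ i)                               ∎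
          where open ≈-Reasoning

    N⊆φ : ∀ v → InN p a v → ∃ λ x → VecCong p (φ x) v
    N⊆φ v v∈N =
      let W , v≈wrap  = N⊆wrap-*ₚf v∈N
          x , φx≈wrap = wrap-*ₚf∈φ W
      in  x , λ i → ≈⇒Cong (≈-trans (φx≈wrap i) (≈-sym (v≈wrap i)))

    N≅ℤₚ^t : NIsoCyclicPower k p a t
    N≅ℤₚ^t = φ , φ-cong , φ-⊕ , φ-injective , φ∈N , N⊆φ

  N≅ℤₚ^[k∸d] : ∀ g d → IsPGcd p f xᵏ-1 g → PDegree p g d → NIsoCyclicPower k p a (k ∸ d)
  N≅ℤₚ^[k∸d] g d (g∣f , g∣xᵏ-1 , greatest) g-degree =
    let g-deg                  = PDegree⇒HasDegree {d} {g} g-degree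
        divides h gh≈xᵏ-1      = PDiv⇒∣ₚ {g} {xᵏ-1} g∣xᵏ-1
        divides f′ gf′≈f       = PDiv⇒∣ₚ {g} {f} g∣f
        t , d+t≡k , h-deg      = cofactor-hasDegree {d} {g} {h} g-deg gh≈xᵏ-1
        g∈ = gcd-∈⟨⟩ (degreeBelow-tabulate a) λ E E∣f E∣xᵏ-1 →
               PDiv⇒∣ₚ {E} {g} (greatest E (∣ₚ⇒PDiv {E} {f} E∣f) (∣ₚ⇒PDiv {E} {xᵏ-1} E∣xᵏ-1))
    in  ≡.subst (NIsoCyclicPower k p a) (≡.sym (≡.trans (≡.cong (_∸ d) (≡.sym d+t≡k)) (m+n∸m≡n d t)))
                (Parametrisation.N≅ℤₚ^t {d} {t} {g} {h} d+t≡k g-deg h-deg g∈ gf′≈f gh≈xᵏ-1)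

proposition6 : (p k : ℕ) → Prime p → 2 ≤ k → (a : Fin k → ℕ) → IsAlgebraicGon k p a
    → (g : Poly) (d : ℕ) → IsPGcd p (gonPoly a) (xk-1 p k) g → PDegree p g d
    → NIsoCyclicPower k p a (k ∸ d)
proposition6 p (suc m) p-prime _ a _ g d = CirculantIdeal.N≅ℤₚ^[k∸d] p p-prime m a g d
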